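{- Let $n\ge 2$ and $m$ be positive integers, and let $R=\{x\in\mathbb{R}^n : x_1>x_2>\cdots>x_n>x_1-m\}$. Let $\eta,\lambda\in R$ be points each of whose coordinates are either all integers or all half-integers. For $k\ge0$ let $b_{\eta\lambda,k}$ be the number of walks of $k$ steps in $\mathbb{R}^n$ from $\eta$ to $\lambda$, each step being one of the $2^n$ vectors $(\pm\tfrac12,\ldots,\pm\tfrac12)$, all of whose points lie in $R$. Then $$b_{\eta\lambda,k}=\sum_{\substack{(t_1,\ldots,t_n)\in\mathbb{Z}^n\\ t_1+\cdots+t_n=0}}\det_{1\le i,j\le n}\left[\binom{k}{k/2+mt_i+\lambda_j-\eta_i}\right],$$ where $\binom{k}{a}=0$ unless $a$ is an integer with $0\le a\le k$ (so only finitely many terms are nonzero).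
   Context: A walk of $k$ steps from $\eta$ to $\lambda$ is a sequence of points $\eta=p_0,\ldots,p_k=\lambda$ with each $p_\ell-p_{\ell-1}$ an allowed step. The region $R$ is the alcove of the affine Weyl group $\tilde A_{n-1}$ rescaled by $m$, considered in all of $\mathbb{R}^n$. -}

module Defs where

open import Data.Nat as ℕ using (ℕ; zero; suc)
open import Data.Nat.Combinatorics using (_C_)
open import Data.Integer as ℤ using (ℤ; +_; -[1+_]; _+_; _-_; _*_; -_; _<?_)
open import Data.Integer.Divisibility using (_∣_)
open import Data.Fin using (Fin; zero; suc; punchIn; toℕ)
open import Data.Sum using (_⊎_)
open import Data.Vec using (Vec; []; _∷_; lookup; head; last; foldr)
open import Data.Vec.Properties using (≡-dec)
open import Data.List as List using (List; []; _∷_; concatMap; filter; map; upTo; allFin)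
open import Data.Bool using (Bool; true; false; _∧_; if_then_else_)
open import Relation.Nullary.Decidable using (⌊_⌋; yes; no; does)
open import Relation.Binary.PropositionalEquality using (_≡_)

-- CONVENTION: all points are scaled by 2, so that integer / half-integer
-- points of ℝⁿ become integer vectors, and the steps (±1/2,…,±1/2)
-- become (±1,…,±1).

decreasingᵇ : ∀ {n} → Vec ℤ n → Bool
decreasingᵇ [] = true
decreasingᵇ (x ∷ []) = true
decreasingᵇ (x ∷ y ∷ ys) = ⌊ y <? x ⌋ ∧ decreasingᵇ (y ∷ ys)

inR2ᵇ : ℕ → ∀ {n} → Vec ℤ n → Bool
inR2ᵇ m [] = true
inR2ᵇ m (x ∷ xs) = decreasingᵇ (x ∷ xs) ∧ ⌊ (x - (+ (2 ℕ.* m))) <? last (x ∷ xs) ⌋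

steps : (n : ℕ) → List (Vec ℤ n)
steps zero = [] ∷ []
steps (suc n) = concatMap (λ v → (+ 1 ∷ v) ∷ (- + 1 ∷ v) ∷ []) (steps n)

vadd : ∀ {n} → Vec ℤ n → Vec ℤ n → Vec ℤ n
vadd [] [] = []
vadd (x ∷ xs) (y ∷ ys) = (x + y) ∷ vadd xs ys

sumℕ : List ℕ → ℕ
sumℕ = List.foldr ℕ._+_ 0

sumℤ : List ℤ → ℤ
sumℤ = List.foldr _+_ (+ 0)

walks : ∀ {n} → ℕ → ℕ → Vec ℤ n → Vec ℤ n → ℕ
walks zero m p q =
  if inR2ᵇ m p ∧ does (≡-dec ℤ._≟_ p q) then 1 else 0
walks {n} (suc k) m p q =
  if inR2ᵇ m p then sumℕ (map (λ s → walks k m (vadd p s) q) (steps n)) else 0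

-- halfBinom k N = binom(k, N/2), which is 0 unless N/2 is an integer in [0,k]
halfBinom : ℕ → ℤ → ℤ
halfBinom k (+ N) = if ⌊ ℕ._≟_ (N ℕ.% 2) 0 ⌋ then + (k C (N ℕ./ 2)) else + 0
halfBinom k -[1+ N ] = + 0

det : (n : ℕ) → (Fin n → Fin n → ℤ) → ℤ
det zero M = + 1
det (suc n) M =
  sumℤ (map (λ j → sgn (toℕ j) * M zero j
                   * det n (λ r c → M (suc r) (punchIn j c))) (allFin (suc n)))
  where
  sgn : ℕ → ℤ
  sgn j = if ⌊ ℕ._≟_ (j ℕ.% 2) 0 ⌋ then + 1 else - + 1

box : ℕ → (n : ℕ) → List (Vec ℤ n)
box B zero = [] ∷ []
box B (suc n) =
  concatMap (λ v → map (λ a → (+ a - + B) ∷ v) (upTo (suc (2 ℕ.* B)))) (box B n)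

vsum : ∀ {n} → Vec ℤ n → ℤ
vsum = foldr _ _+_ (+ 0)

inBox : ℕ → ∀ {n} → Vec ℤ n → Set
inBox B t = ∀ i → ℤ.∣ lookup t i ∣ ℕ.≤ B

-- the summand: det [ binom(k, k/2 + m tᵢ + λⱼ − ηᵢ) ], in scaled coordinates
-- (e = 2η, l = 2λ):  k/2 + m tᵢ + λⱼ − ηᵢ = (k + 2 m tᵢ + lⱼ − eᵢ)/2
summand : ∀ {n} → ℕ → ℕ → Vec ℤ n → Vec ℤ n → Vec ℤ n → ℤ
summand {n} k m e l t =
  det n (λ i j → halfBinom k (+ k + + (2 ℕ.* m) * lookup t i + lookup l j - lookup e i))

boxSum : ∀ {n} → ℕ → ℕ → ℕ → Vec ℤ n → Vec ℤ n → ℤ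
boxSum {n} B k m e l =
  sumℤ (map (summand k m e l) (filter (λ t → vsum t ℤ.≟ + 0) (box B n)))

-- all coordinates integers (scaled: even) or all half-integers (scaled: odd)
sameParity : ∀ {n} → Vec ℤ n → Set
sameParity {n} e = (∀ i → + 2 ∣ lookup e i) ⊎ (∀ i → + 2 ∣ (lookup e i + + 1))

InR2 : ℕ → ∀ {n} → Vec ℤ n → Set
InR2 m y = inR2ᵇ m y ≡ true

-- Reflection principle for walks in an alcove (Gessel–Zeilberger).  Scaling by 2 makes the steps
-- (±1,…,±1) and R the alcove p₀ > p₁ > ⋯ > pₙ₋₁ > p₀ − 2m.  Fix the endpoint l and let F_k(p) be the
-- right-hand side, a sum over t with Σ t = 0 of det[binom(k, (k + 2m tᵢ + lⱼ − pᵢ)/2)].  Pascal's rule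
-- in every row and multilinearity give F_{k+1}(p) = Σ_s F_k(p + s); for k = 0 and p ∈ R only t = 0
-- contributes, leaving det[δ(pᵢ, lⱼ)] = [p = l]; and F_k vanishes on the walls of R, because exchanging
-- tᵢ and tⱼ (when pᵢ = pⱼ), or sending (t₀, tₙ₋₁) to (tₙ₋₁ + 1, t₀ − 1) (when pₙ₋₁ = p₀ − 2m), preserves
-- Σ t = 0 and swaps two rows of the determinant.  As the coordinates of p keep a common parity, a step
-- leaving R lands on a wall, so the walk counts obey the same recursion and boundary values, and
-- induction on k concludes.  A term vanishes once some ∣tᵢ∣ exceeds k plus the distance from p to l, so
-- the sum can be taken over a box that is large enough to be invariant under these maps.

module Submission where

open import Defs
open import Data.Bool using (true; false; if_then_else_; _∧_)
open import Data.Bool.Properties using (∧-conicalˡ; ∧-conicalʳ)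
open import Data.Empty using (⊥-elim)
open import Data.Fin as F using (Fin; zero; suc; punchIn; toℕ)
import Data.Fin.Permutation as Perm
open import Data.Fin.Permutation.Components using (transpose)
import Data.Fin.Properties as FP
open import Data.Integer as ℤ using (ℤ; +_; -[1+_]; _+_; _-_; _*_; -_)
open import Data.Integer.Divisibility.Signed
  using (_∣_; divides; ∣ᵤ⇒∣; ∣⇒∣ᵤ; ∣m∣n⇒∣m+n; ∣m∣n⇒∣m-n)
import Data.Integer.Properties as ℤP
open import Data.Integer.Tactic.RingSolver using (solve-∀)
open import Data.List as L using (List; []; _∷_; _++_; upTo)
import Data.List.Properties as LP
open import Data.List.Relation.Unary.All as All using (All; []; _∷_)
open import Data.List.Relation.Unary.All.Properties using (concat⁺; map⁺)
open import Data.Nat as ℕ using (ℕ; zero; suc; _≥_)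
open import Data.Nat.Combinatorics using (_C_; k>n⇒nCk≡0; nCk+nC[k+1]≡[n+1]C[k+1])
import Data.Nat.DivMod as ℕD
import Data.Nat.Divisibility as ℕ∣
import Data.Nat.Properties as ℕP
open import Data.Product using (Σ; ∃-syntax; _×_; _,_; proj₁; proj₂)
open import Data.Sum using (_⊎_; inj₁; inj₂)
open import Data.Unit using (⊤; tt)
open import Data.Vec as V using (Vec; []; _∷_; lookup; updateAt)
import Data.Vec.Properties as VP
open import Function using (_∘_; id)
open import Relation.Binary.Definitions using (tri<; tri≈; tri>)
open import Relation.Binary.PropositionalEquality
open import Relation.Nullary using (¬_; Dec; yes; no)
open import Relation.Nullary.Decidable using (⌊_⌋; does; dec-true; dec-false)

open import Algebra.Properties.CommutativeMonoid.Sum ℤP.+-0-commutativeMonoid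
open import Algebra.Properties.Semiring.Sum ℤP.+-*-semiring using (*-distribˡ-sum)

-- Finite sums

∑ˡ : {A : Set} → List A → (A → ℤ) → ℤ
∑ˡ xs f = sumℤ (L.map f xs)

infixl 10 ∑ˡ
syntax ∑ˡ xs (λ x → e) = ∑[ x ∈ xs ] e

module _ {A : Set} where

  ∑ˡ-cong : ∀ xs {f g : A → ℤ} → (∀ x → f x ≡ g x) → ∑ˡ xs f ≡ ∑ˡ xs g
  ∑ˡ-cong [] f≗g = refl
  ∑ˡ-cong (x ∷ xs) f≗g = cong₂ _+_ (f≗g x) (∑ˡ-cong xs f≗g)

  ∑ˡ-cong-All : ∀ {xs} {f g : A → ℤ} → All (λ x → f x ≡ g x) xs → ∑ˡ xs f ≡ ∑ˡ xs g
  ∑ˡ-cong-All [] = refl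
  ∑ˡ-cong-All (fx≡gx ∷ rest) = cong₂ _+_ fx≡gx (∑ˡ-cong-All rest)

  ∑ˡ-zero : ∀ xs {f : A → ℤ} → (∀ x → f x ≡ + 0) → ∑ˡ xs f ≡ + 0
  ∑ˡ-zero [] f≗0 = refl
  ∑ˡ-zero (x ∷ xs) f≗0 = cong₂ _+_ (f≗0 x) (∑ˡ-zero xs f≗0)

  ∑ˡ-distrib-+ : ∀ xs (f g : A → ℤ) → ∑[ x ∈ xs ] (f x + g x) ≡ ∑ˡ xs f + ∑ˡ xs g
  ∑ˡ-distrib-+ [] f g = refl
  ∑ˡ-distrib-+ (x ∷ xs) f g =
    trans (cong (_+_ (f x + g x)) (∑ˡ-distrib-+ xs f g)) (interchange (f x) (g x) _ _)
    where
    interchange : ∀ a b c d → a + b + (c + d) ≡ a + c + (b + d)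
    interchange = solve-∀

  ∑ˡ-neg : ∀ xs (f : A → ℤ) → ∑[ x ∈ xs ] (- f x) ≡ - ∑ˡ xs f
  ∑ˡ-neg [] f = refl
  ∑ˡ-neg (x ∷ xs) f =
    trans (cong (_+_ (- f x)) (∑ˡ-neg xs f)) (sym (ℤP.neg-distrib-+ (f x) _))

  *-distribˡ-∑ˡ : ∀ c xs (f : A → ℤ) → c * ∑ˡ xs f ≡ ∑[ x ∈ xs ] (c * f x)
  *-distribˡ-∑ˡ c [] f = ℤP.*-zeroʳ c
  *-distribˡ-∑ˡ c (x ∷ xs) f =
    trans (ℤP.*-distribˡ-+ c (f x) _) (cong (_+_ (c * f x)) (*-distribˡ-∑ˡ c xs f))

  ∑ˡ-++ : ∀ xs ys (f : A → ℤ) → ∑ˡ (xs ++ ys) f ≡ ∑ˡ xs f + ∑ˡ ys f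
  ∑ˡ-++ [] ys f = sym (ℤP.+-identityˡ _)
  ∑ˡ-++ (x ∷ xs) ys f = trans (cong (_+_ (f x)) (∑ˡ-++ xs ys f)) (sym (ℤP.+-assoc (f x) _ _))

  ∑ˡ-filter : ∀ {P : A → Set} (P? : ∀ x → Dec (P x)) xs (f : A → ℤ) →
              ∑ˡ (L.filter P? xs) f ≡ ∑[ x ∈ xs ] (if does (P? x) then f x else + 0)
  ∑ˡ-filter P? [] f = refl
  ∑ˡ-filter P? (x ∷ xs) f with does (P? x)
  ... | true  = cong (_+_ (f x)) (∑ˡ-filter P? xs f)
  ... | false = trans (∑ˡ-filter P? xs f) (sym (ℤP.+-identityˡ _))

  +-sumℕ : ∀ xs (f : A → ℕ) → + sumℕ (L.map f xs) ≡ ∑[ x ∈ xs ] (+ f x)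
  +-sumℕ [] f = refl
  +-sumℕ (x ∷ xs) f = trans (ℤP.pos-+ (f x) _) (cong (_+_ (+ f x)) (+-sumℕ xs f))

module _ {A B : Set} where

  ∑ˡ-comm : ∀ xs ys (f : A → B → ℤ) →
            ∑[ x ∈ xs ] ∑[ y ∈ ys ] f x y ≡ ∑[ y ∈ ys ] ∑[ x ∈ xs ] f x y
  ∑ˡ-comm [] ys f = sym (∑ˡ-zero ys (λ _ → refl))
  ∑ˡ-comm (x ∷ xs) ys f =
    trans (cong (_+_ (∑ˡ ys (f x))) (∑ˡ-comm xs ys f))
          (sym (∑ˡ-distrib-+ ys (f x) (λ y → ∑[ x ∈ xs ] f x y)))

  ∑ˡ-concatMap : ∀ xs (g : A → List B) (f : B → ℤ) →
                 ∑ˡ (L.concatMap g xs) f ≡ ∑[ x ∈ xs ] ∑ˡ (g x) f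
  ∑ˡ-concatMap [] g f = refl
  ∑ˡ-concatMap (x ∷ xs) g f =
    trans (∑ˡ-++ (g x) _ f) (cong (_+_ (∑ˡ (g x) f)) (∑ˡ-concatMap xs g f))

  ∑ˡ-map : ∀ xs (g : A → B) (f : B → ℤ) → ∑ˡ (L.map g xs) f ≡ ∑ˡ xs (f ∘ g)
  ∑ˡ-map xs g f = cong sumℤ (sym (LP.map-∘ xs))

∑-∑ˡ-comm : ∀ {A : Set} n xs (f : Fin n → A → ℤ) →
            ∑[ j < n ] ∑[ x ∈ xs ] f j x ≡ ∑[ x ∈ xs ] ∑[ j < n ] f j x
∑-∑ˡ-comm zero xs f = sym (∑ˡ-zero xs (λ _ → refl))
∑-∑ˡ-comm (suc n) xs f =
  trans (cong (_+_ (∑ˡ xs (f zero))) (∑-∑ˡ-comm n xs (f ∘ suc)))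
        (sym (∑ˡ-distrib-+ xs (f zero) (λ x → ∑[ j < n ] f (suc j) x)))

sumℤ-tabulate : ∀ n (f : Fin n → ℤ) → sumℤ (L.tabulate f) ≡ sum f
sumℤ-tabulate zero f = refl
sumℤ-tabulate (suc n) f = cong (_+_ (f zero)) (sumℤ-tabulate n (f ∘ suc))

sum-zero : ∀ n {f : Fin n → ℤ} → (∀ i → f i ≡ + 0) → sum f ≡ + 0
sum-zero n f≗0 = trans (sum-cong-≗ f≗0) (sum-replicate-zero n)

sum-neg : ∀ n (f : Fin n → ℤ) → ∑[ i < n ] (- f i) ≡ - sum f
sum-neg zero f = refl
sum-neg (suc n) f = trans (cong (_+_ (- f zero)) (sum-neg n (f ∘ suc))) (sym (ℤP.neg-distrib-+ (f zero) _))

sum-δ : ∀ n (j : Fin (suc n)) {f : Fin (suc n) → ℤ} → (∀ i → i ≢ j → f i ≡ + 0) → sum f ≡ f j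
sum-δ n j {f} f≗0 = trans (sum-remove {i = j} f)
  (trans (cong (_+_ (f j)) (sum-zero n (λ c → f≗0 (punchIn j c) (FP.punchInᵢ≢i j c))))
         (ℤP.+-identityʳ (f j)))

-- Transpositions

transpose-suc : ∀ {n} (i j x : Fin n) → transpose (suc i) (suc j) (suc x) ≡ suc (transpose i j x)
transpose-suc i j x with does (x F.≟ i)
... | true = refl
... | false with does (x F.≟ j)
...   | true = refl
...   | false = refl

transpose-matchˡ : ∀ {n} (i j : Fin n) → transpose i j i ≡ j
transpose-matchˡ i j rewrite dec-true (i F.≟ i) refl = refl

transpose-matchʳ : ∀ {n} (i j : Fin n) → transpose i j j ≡ i
transpose-matchʳ i j with j F.≟ i
... | yes j≡i = j≡i
... | no _ rewrite dec-true (j F.≟ j) refl = refl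

transpose-other : ∀ {n} {i j x : Fin n} → x ≢ i → x ≢ j → transpose i j x ≡ x
transpose-other {i = i} {j} {x} x≢i x≢j
  rewrite dec-false (x F.≟ i) x≢i | dec-false (x F.≟ j) x≢j = refl

transpose-comm : ∀ {n} (i j x : Fin n) → transpose i j x ≡ transpose j i x
transpose-comm i j x = byCases (x F.≟ i) (x F.≟ j)
  where
  byCases : Dec (x ≡ i) → Dec (x ≡ j) → transpose i j x ≡ transpose j i x
  byCases (yes refl) _ = trans (transpose-matchˡ x j) (sym (transpose-matchʳ j x))
  byCases (no _) (yes refl) = trans (transpose-matchʳ i x) (sym (transpose-matchˡ x i))
  byCases (no x≢i) (no x≢j) = trans (transpose-other x≢i x≢j) (sym (transpose-other x≢j x≢i))

transpose-respects : ∀ {n} (p : Vec ℤ n) {i j} → lookup p i ≡ lookup p j →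
                     ∀ r → lookup p (transpose i j r) ≡ lookup p r
transpose-respects p {i} {j} pᵢ≡pⱼ r = byCases (r F.≟ i) (r F.≟ j)
  where
  byCases : Dec (r ≡ i) → Dec (r ≡ j) → lookup p (transpose i j r) ≡ lookup p r
  byCases (yes refl) _ = trans (cong (lookup p) (transpose-matchˡ r j)) (sym pᵢ≡pⱼ)
  byCases (no _) (yes refl) = trans (cong (lookup p) (transpose-matchʳ i r)) pᵢ≡pⱼ
  byCases (no r≢i) (no r≢j) = cong (lookup p) (transpose-other r≢i r≢j)

transpose-conj : ∀ {n} (j : Fin (suc n)) (x : Fin (suc (suc (suc n)))) →
  transpose zero (suc (suc j)) x ≡
  transpose (suc zero) (suc (suc j)) (transpose zero (suc zero) (transpose (suc zero) (suc (suc j)) x))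
transpose-conj j zero = refl
transpose-conj j (suc zero) = sym (transpose-matchʳ (suc zero) (suc (suc j)))
transpose-conj j (suc (suc y)) = byCases (y F.≟ j)
  where
  t₁ : Fin _ → Fin _
  t₁ = transpose (suc zero) (suc (suc j))
  t₀₁ : Fin _ → Fin _
  t₀₁ = transpose zero (suc zero)
  byCases : Dec (y ≡ j) → transpose zero (suc (suc j)) (suc (suc y)) ≡ t₁ (t₀₁ (t₁ (suc (suc y))))
  byCases (yes refl) = trans (transpose-matchʳ zero (suc (suc y)))
                             (cong (t₁ ∘ t₀₁) (sym (transpose-matchʳ (suc zero) (suc (suc y)))))
  byCases (no y≢j) = trans (transpose-other {i = zero} (λ ()) y+2≢j+2)
                           (sym (trans (cong (t₁ ∘ t₀₁) (transpose-other {i = suc zero} (λ ()) y+2≢j+2))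
                                       (transpose-other {i = suc zero} (λ ()) y+2≢j+2)))
    where
    y+2≢j+2 : suc (suc y) ≢ suc (suc j)
    y+2≢j+2 = y≢j ∘ FP.suc-injective ∘ FP.suc-injective

-- Every transposition arises from (0 1) by shifting indices and by conjugation, (0 k) = (1 k)(0 1)(1 k).
module _ (P : ∀ {n} → Fin n → Fin n → Set)
         (P-01 : ∀ {n} → P {suc (suc n)} zero (suc zero))
         (P-suc : ∀ {n} {i j : Fin n} → P i j → P (suc i) (suc j))
         (P-sym : ∀ {n} {i j : Fin n} → P i j → P j i)
         (P-conj : ∀ {n} {j : Fin (suc n)} →
                   P (suc zero) (suc (suc j)) → P {suc (suc (suc n))} zero (suc zero) → P zero (suc (suc j)))
  where

  transposition-fromZero : ∀ {n} (j : Fin (suc n)) → P zero (suc j)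
  transposition-fromZero zero = P-01
  transposition-fromZero {suc n} (suc j) = P-conj (P-suc (transposition-fromZero j)) P-01

  transposition-induction : ∀ {n} (i j : Fin n) → i ≢ j → P i j
  transposition-induction zero zero i≢j = ⊥-elim (i≢j refl)
  transposition-induction {suc (suc n)} zero (suc j) _ = transposition-fromZero j
  transposition-induction {suc (suc n)} (suc i) zero _ = P-sym (transposition-fromZero i)
  transposition-induction (suc i) (suc j) i≢j = P-suc (transposition-induction i j (i≢j ∘ cong suc))

-- Determinants

Matrix : ℕ → Set
Matrix n = Fin n → Fin n → ℤ

sign : ℕ → ℤ
sign j = if ⌊ ℕ._≟_ (j ℕ.% 2) 0 ⌋ then + 1 else - + 1

sign-+2 : ∀ j → sign (2 ℕ.+ j) ≡ sign j
sign-+2 j = trans (cong sign (ℕP.+-comm 2 j))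
                  (cong (λ r → if ⌊ ℕ._≟_ r 0 ⌋ then + 1 else - + 1) (ℕD.[m+n]%n≡m%n j 2))

sign-suc : ∀ j → sign (suc j) ≡ - sign j
sign-suc zero = refl
sign-suc (suc zero) = refl
sign-suc (suc (suc j)) = trans (sign-+2 (suc j)) (trans (sign-suc j) (cong -_ (sym (sign-+2 j))))

minor : ∀ {n} → Matrix (suc n) → Fin (suc n) → Matrix n
minor M j r c = M (suc r) (punchIn j c)

expansionTerm : ∀ n → Matrix (suc n) → Fin (suc n) → ℤ
expansionTerm n M j = sign (toℕ j) * M zero j * det n (minor M j)

det-expand : ∀ n (M : Matrix (suc n)) → det (suc n) M ≡ sum (expansionTerm n M)
det-expand n M = trans (cong sumℤ (LP.map-tabulate id (expansionTerm n M)))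
                       (sumℤ-tabulate (suc n) (expansionTerm n M))

expansionTerm-zero : ∀ n (M : Matrix (suc n)) j → M zero j ≡ + 0 → expansionTerm n M j ≡ + 0
expansionTerm-zero n M j M₀ⱼ≡0 = begin
  sign (toℕ j) * M zero j * det n (minor M j)
    ≡⟨ cong (λ x → sign (toℕ j) * x * det n (minor M j)) M₀ⱼ≡0 ⟩
  sign (toℕ j) * + 0 * det n (minor M j)
    ≡⟨ cong (_* det n (minor M j)) (ℤP.*-zeroʳ (sign (toℕ j))) ⟩
  + 0 * det n (minor M j)
    ≡⟨ ℤP.*-zeroˡ (det n (minor M j)) ⟩
  + 0 ∎
  where open ≡-Reasoning

det-cong : ∀ n {M N : Matrix n} → (∀ r c → M r c ≡ N r c) → det n M ≡ det n N
det-cong zero M≗N = refl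
det-cong (suc n) {M} {N} M≗N = begin
  det (suc n) M         ≡⟨ det-expand n M ⟩
  sum (expansionTerm n M) ≡⟨ sum-cong-≗ (λ j → cong₂ (λ x y → sign (toℕ j) * x * y) (M≗N zero j)
                                                   (det-cong n (λ r c → M≗N (suc r) (punchIn j c)))) ⟩
  sum (expansionTerm n N) ≡⟨ det-expand n N ⟨
  det (suc n) N         ∎
  where open ≡-Reasoning

det-zeroRow : ∀ n (M : Matrix n) i → (∀ c → M i c ≡ + 0) → det n M ≡ + 0
det-zeroRow (suc n) M zero Mᵢ≡0 =
  trans (det-expand n M) (sum-zero (suc n) (λ j → expansionTerm-zero n M j (Mᵢ≡0 j)))
det-zeroRow (suc n) M (suc i) Mᵢ≡0 = trans (det-expand n M) (sum-zero (suc n) (λ j →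
  trans (cong (sign (toℕ j) * M zero j *_) (det-zeroRow n (minor M j) i (Mᵢ≡0 ∘ punchIn j)))
        (ℤP.*-zeroʳ (sign (toℕ j) * M zero j))))

det-zeroColumn : ∀ n (M : Matrix n) c → (∀ r → M r c ≡ + 0) → det n M ≡ + 0
det-zeroColumn (suc n) M c Mᶜ≡0 = trans (det-expand n M) (sum-zero (suc n) term≡0)
  where
  term≡0 : ∀ j → expansionTerm n M j ≡ + 0
  term≡0 j with j F.≟ c
  ... | yes refl = expansionTerm-zero n M j (Mᶜ≡0 zero)
  ... | no j≢c = trans (cong (sign (toℕ j) * M zero j *_)
                   (det-zeroColumn n (minor M j) (F.punchOut j≢c)
                     (λ r → trans (cong (M (suc r)) (FP.punchIn-punchOut j≢c)) (Mᶜ≡0 (suc r)))))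
                   (ℤP.*-zeroʳ (sign (toℕ j) * M zero j))

det-nonzero⇒row-nonzero : ∀ n (M : Matrix n) → det n M ≢ + 0 → ∀ i → ∃[ c ] M i c ≢ + 0
det-nonzero⇒row-nonzero n M det≢0 i with FP.all? (λ c → M i c ℤ.≟ + 0)
... | yes row≡0 = ⊥-elim (det≢0 (det-zeroRow n M i row≡0))
... | no row≢0 = FP.¬∀⟶∃¬ n _ (λ c → M i c ℤ.≟ + 0) row≢0

sum-minus : ∀ n (f g : Fin n → ℤ) → ∑[ i < n ] (f i - g i) ≡ sum f - sum g
sum-minus n f g = trans (∑-distrib-+ f (λ i → - g i)) (cong (_+_ (sum f)) (sum-neg n g))

punchOut′ : ∀ {n} → Fin (suc (suc n)) → Fin (suc (suc n)) → Fin (suc n)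
punchOut′ zero zero = zero
punchOut′ zero (suc b) = b
punchOut′ (suc j) zero = zero
punchOut′ {zero} (suc j) (suc b) = zero
punchOut′ {suc n} (suc j) (suc b) = suc (punchOut′ j b)

punchOut′-punchIn : ∀ {n} (j : Fin (suc (suc n))) c → punchOut′ j (punchIn j c) ≡ c
punchOut′-punchIn zero c = refl
punchOut′-punchIn (suc j) zero = refl
punchOut′-punchIn {suc n} (suc j) (suc c) = cong suc (punchOut′-punchIn j c)

punchIn-punchOut′-comm : ∀ {n} {j b : Fin (suc (suc n))} → j ≢ b → ∀ x →
  punchIn j (punchIn (punchOut′ j b) x) ≡ punchIn b (punchIn (punchOut′ b j) x)
punchIn-punchOut′-comm {j = zero} {zero} j≢b x = ⊥-elim (j≢b refl)
punchIn-punchOut′-comm {j = zero} {suc b} j≢b x = refl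
punchIn-punchOut′-comm {j = suc j} {zero} j≢b x = refl
punchIn-punchOut′-comm {zero} {suc zero} {suc zero} j≢b x = ⊥-elim (j≢b refl)
punchIn-punchOut′-comm {suc n} {suc j} {suc b} j≢b zero = refl
punchIn-punchOut′-comm {suc n} {suc j} {suc b} j≢b (suc x) =
  cong suc (punchIn-punchOut′-comm (j≢b ∘ cong suc) x)

sign-punchOut′-antisym : ∀ {n} {j b : Fin (suc (suc n))} → j ≢ b →
  sign (toℕ j) * sign (toℕ (punchOut′ j b)) ≡ - (sign (toℕ b) * sign (toℕ (punchOut′ b j)))
sign-punchOut′-antisym {j = zero} {zero} j≢b = ⊥-elim (j≢b refl)
sign-punchOut′-antisym {j = zero} {suc b} j≢b rewrite sign-suc (toℕ b) = lemma (sign (toℕ b))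
  where lemma : ∀ x → + 1 * x ≡ - (- x * + 1)
        lemma = solve-∀
sign-punchOut′-antisym {j = suc j} {zero} j≢b rewrite sign-suc (toℕ j) = lemma (sign (toℕ j))
  where lemma : ∀ x → - x * + 1 ≡ - (+ 1 * x)
        lemma = solve-∀
sign-punchOut′-antisym {zero} {suc zero} {suc zero} j≢b = ⊥-elim (j≢b refl)
sign-punchOut′-antisym {suc n} {suc j} {suc b} j≢b
  rewrite sign-suc (toℕ j) | sign-suc (toℕ b)
        | sign-suc (toℕ (punchOut′ j b)) | sign-suc (toℕ (punchOut′ b j)) =
  trans (neg*neg (sign (toℕ j)) _)
        (trans (sign-punchOut′-antisym (j≢b ∘ cong suc)) (cong -_ (sym (neg*neg (sign (toℕ b)) _))))
  where neg*neg : ∀ a c → (- a) * (- c) ≡ a * c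
        neg*neg = solve-∀

-- Term of the expansion along rows 0 and 1 taking column j in row 0 and column b in row 1;
-- the diagonal b ≡ j is junk, subtracted again in det-expand₂.
pairTerm : ∀ {n} (R₀ R₁ : Fin (suc (suc n)) → ℤ) → Matrix (suc (suc n)) →
           Fin (suc (suc n)) → Fin (suc (suc n)) → ℤ
pairTerm {n} R₀ R₁ M j b =
  sign (toℕ j) * sign (toℕ (punchOut′ j b)) * R₀ j * R₁ b * det n (minor (minor M j) (punchOut′ j b))

det-expand₂ : ∀ n (M : Matrix (suc (suc n))) → let T = pairTerm (M zero) (M (suc zero)) M in
  det (suc (suc n)) M ≡ ∑[ j < suc (suc n) ] (sum (T j) - T j j)
det-expand₂ n M = trans (det-expand (suc n) M) (sum-cong-≗ expandRow₁)
  where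
  T = pairTerm (M zero) (M (suc zero)) M
  termAt-punchIn : ∀ j c → sign (toℕ j) * M zero j * expansionTerm n (minor M j) c ≡ T j (punchIn j c)
  termAt-punchIn j c rewrite punchOut′-punchIn j c =
    lemma (sign (toℕ j)) (M zero j) (sign (toℕ c)) (M (suc zero) (punchIn j c)) (det n (minor (minor M j) c))
    where lemma : ∀ a m c n d → a * m * (c * n * d) ≡ a * c * m * n * d
          lemma = solve-∀
  expandRow₁ : ∀ j → expansionTerm (suc n) M j ≡ sum (T j) - T j j
  expandRow₁ j = begin
    sign (toℕ j) * M zero j * det (suc n) (minor M j)
      ≡⟨ cong (sign (toℕ j) * M zero j *_) (det-expand n (minor M j)) ⟩
    sign (toℕ j) * M zero j * sum (expansionTerm n (minor M j))
      ≡⟨ *-distribˡ-sum (sign (toℕ j) * M zero j) (expansionTerm n (minor M j)) ⟩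
    ∑[ c < suc n ] (sign (toℕ j) * M zero j * expansionTerm n (minor M j) c)
      ≡⟨ sum-cong-≗ (termAt-punchIn j) ⟩
    ∑[ c < suc n ] T j (punchIn j c)
      ≡⟨ addThenSubtract (sum-remove {i = j} (T j)) ⟨
    sum (T j) - T j j ∎
    where
    open ≡-Reasoning
    addThenSubtract : ∀ {s x r} → s ≡ x + r → s - x ≡ r
    addThenSubtract {s} {x} {r} refl = lemma x r
      where lemma : ∀ x r → x + r - x ≡ r
            lemma = solve-∀

det-transpose01 : ∀ n (M : Matrix (suc (suc n))) →
  det (suc (suc n)) (λ r → M (transpose zero (suc zero) r)) ≡ - det (suc (suc n)) M
det-transpose01 n M = begin
  det N (λ r → M (transpose zero (suc zero) r)) ≡⟨ det-expand₂ n (λ r → M (transpose zero (suc zero) r)) ⟩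
  ∑[ j < N ] (sum (T′ j) - T′ j j)              ≡⟨ sum-minus N (sum ∘ T′) (λ j → T′ j j) ⟩
  A - ∑[ j < N ] T′ j j                         ≡⟨ cong (_-_ A) (sum-cong-≗ diagonal) ⟩
  A - d                                         ≡⟨ addSubtract A B d ⟩
  (A + B) - B - d                               ≡⟨ cong (λ x → x - B - d) A+B≡d+d ⟩
  (d + d) - B - d                               ≡⟨ cancel B d ⟩
  - (B - d)                                     ≡⟨ cong -_ (sum-minus N (sum ∘ T) (λ j → T j j)) ⟨
  - ∑[ j < N ] (sum (T j) - T j j)              ≡⟨ cong -_ (det-expand₂ n M) ⟨
  - det N M                                     ∎
  where
  open ≡-Reasoning
  N = suc (suc n)
  T T′ : Fin N → Fin N → ℤ
  T = pairTerm (M zero) (M (suc zero)) M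
  T′ = pairTerm (M (suc zero)) (M zero) M
  A B d : ℤ
  A = ∑[ j < N ] sum (T′ j)
  B = ∑[ j < N ] sum (T j)
  d = ∑[ j < N ] T j j
  diagonal : ∀ j → T′ j j ≡ T j j
  diagonal j = lemma (sign (toℕ j)) (sign (toℕ (punchOut′ j j))) (M (suc zero) j) (M zero j)
                     (det n (minor (minor M j) (punchOut′ j j)))
    where lemma : ∀ a b c d e → a * b * c * d * e ≡ a * b * d * c * e
          lemma = solve-∀
  offDiagonal : ∀ j b → b ≢ j → T′ j b + T b j ≡ + 0
  offDiagonal j b b≢j =
    trans (cong₂ (λ s D → T′ j b + s * M zero b * M (suc zero) j * D)
                 (sign-punchOut′-antisym b≢j)
                 (det-cong n (λ r x → cong (M (suc (suc r))) (punchIn-punchOut′-comm b≢j x))))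
          (lemma (sign (toℕ j) * sign (toℕ (punchOut′ j b))) (M (suc zero) j) (M zero b)
                 (det n (minor (minor M j) (punchOut′ j b))))
    where lemma : ∀ s m₁ m₀ D → s * m₁ * m₀ * D + - s * m₀ * m₁ * D ≡ + 0
          lemma = solve-∀
  A+B≡d+d : A + B ≡ d + d
  A+B≡d+d = begin
    A + B
      ≡⟨ cong (_+_ A) (∑-comm T) ⟩
    A + ∑[ j < N ] ∑[ b < N ] T b j
      ≡⟨ ∑-distrib-+ (sum ∘ T′) (λ j → ∑[ b < N ] T b j) ⟨
    ∑[ j < N ] (sum (T′ j) + ∑[ b < N ] T b j)
      ≡⟨ sum-cong-≗ (λ j → ∑-distrib-+ (T′ j) (λ b → T b j)) ⟨
    ∑[ j < N ] ∑[ b < N ] (T′ j b + T b j)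
      ≡⟨ sum-cong-≗ (λ j → sum-δ (suc n) j (offDiagonal j)) ⟩
    ∑[ j < N ] (T′ j j + T j j)
      ≡⟨ sum-cong-≗ (λ j → cong (_+ T j j) (diagonal j)) ⟩
    ∑[ j < N ] (T j j + T j j)
      ≡⟨ ∑-distrib-+ (λ j → T j j) (λ j → T j j) ⟩
    d + d ∎
  addSubtract : ∀ A B d → A - d ≡ (A + B) - B - d
  addSubtract = solve-∀
  cancel : ∀ B d → (d + d) - B - d ≡ - (B - d)
  cancel = solve-∀

det-transpose : ∀ n (M : Matrix n) {i j : Fin n} → i ≢ j →
  det n (λ r → M (transpose i j r)) ≡ - det n M
det-transpose n M {i} {j} i≢j = transposition-induction Alternates
  (λ {n} → det-transpose01 n) alternates-suc alternates-sym alternates-conj i j i≢j M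
  where
  Alternates : ∀ {n} → Fin n → Fin n → Set
  Alternates {n} i j = ∀ M → det n (λ r → M (transpose i j r)) ≡ - det n M

  alternates-suc : ∀ {n} {i j : Fin n} → Alternates i j → Alternates (suc i) (suc j)
  alternates-suc {n} {i} {j} alt M = begin
    det (suc n) M′
      ≡⟨ det-expand n M′ ⟩
    sum (expansionTerm n M′)
      ≡⟨ sum-cong-≗ (λ c → trans (cong (sign (toℕ c) * M zero c *_) (minor-alternates c))
                                 (sym (ℤP.neg-distribʳ-* (sign (toℕ c) * M zero c) (det n (minor M c))))) ⟩
    ∑[ c < suc n ] (- expansionTerm n M c)
      ≡⟨ sum-neg (suc n) (expansionTerm n M) ⟩
    - sum (expansionTerm n M)
      ≡⟨ cong -_ (det-expand n M) ⟨
    - det (suc n) M ∎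
    where
    open ≡-Reasoning
    M′ : Matrix (suc n)
    M′ r = M (transpose (suc i) (suc j) r)
    minor-alternates : ∀ c → det n (minor M′ c) ≡ - det n (minor M c)
    minor-alternates c =
      trans (det-cong n (λ r x → cong (λ y → M y (punchIn c x)) (transpose-suc i j r))) (alt (minor M c))

  alternates-sym : ∀ {n} {i j : Fin n} → Alternates i j → Alternates j i
  alternates-sym {n} {i} {j} alt M =
    trans (det-cong n (λ r c → cong (λ x → M x c) (transpose-comm j i r))) (alt M)

  alternates-conj : ∀ {n} {j : Fin (suc n)} → Alternates (suc zero) (suc (suc j)) →
                    Alternates {suc (suc (suc n))} zero (suc zero) → Alternates zero (suc (suc j))
  alternates-conj {n} {j} alt₁ alt₀₁ M = begin
    det N (λ r → M (transpose zero (suc (suc j)) r))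
                                                      ≡⟨ det-cong N (λ r c → cong (λ y → M y c) (transpose-conj j r)) ⟩
    det N (λ r → M (t₁ (t₀₁ (t₁ r))))                 ≡⟨ alt₁ (λ r → M (t₁ (t₀₁ r))) ⟩
    - det N (λ r → M (t₁ (t₀₁ r)))                    ≡⟨ cong -_ (alt₀₁ (λ r → M (t₁ r))) ⟩
    - - det N (λ r → M (t₁ r))                        ≡⟨ cong (-_ ∘ -_) (alt₁ M) ⟩
    - - - det N M                                     ≡⟨ ℤP.neg-involutive (- det N M) ⟩
    - det N M                                         ∎
    where
    open ≡-Reasoning
    N = suc (suc (suc n))
    t₁ t₀₁ : Fin N → Fin N
    t₁ = transpose (suc zero) (suc (suc j))
    t₀₁ = transpose zero (suc zero)

det-multilinear-steps : ∀ n (F : Fin n → Fin n → ℤ → ℤ) →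
  det n (λ i j → F i j (+ 1) + F i j (- + 1)) ≡ ∑[ s ∈ steps n ] det n (λ i j → F i j (lookup s i))
det-multilinear-steps zero F = refl
det-multilinear-steps (suc n) F = begin
  det (suc n) (λ i j → F i j (+ 1) + F i j (- + 1))
    ≡⟨ det-expand n (λ i j → F i j (+ 1) + F i j (- + 1)) ⟩
  ∑[ j < suc n ] (sign (toℕ j) * (a j + b j) * det n (λ r c → Fᵣ j r c (+ 1) + Fᵣ j r c (- + 1)))
    ≡⟨ sum-cong-≗ (λ j → trans (cong (sign (toℕ j) * (a j + b j) *_) (det-multilinear-steps n (Fᵣ j)))
                               (*-distribˡ-∑ˡ (sign (toℕ j) * (a j + b j)) (steps n) (D j))) ⟩
  ∑[ j < suc n ] ∑[ v ∈ steps n ] (sign (toℕ j) * (a j + b j) * D j v)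
    ≡⟨ ∑-∑ˡ-comm (suc n) (steps n) (λ j v → sign (toℕ j) * (a j + b j) * D j v) ⟩
  ∑[ v ∈ steps n ] ∑[ j < suc n ] (sign (toℕ j) * (a j + b j) * D j v)
    ≡⟨ ∑ˡ-cong (steps n) splitFirstRow ⟩
  ∑[ v ∈ steps n ] ∑ˡ ((+ 1 ∷ v) ∷ (- + 1 ∷ v) ∷ []) detAt
    ≡⟨ ∑ˡ-concatMap (steps n) (λ v → (+ 1 ∷ v) ∷ (- + 1 ∷ v) ∷ []) detAt ⟨
  ∑[ s ∈ steps (suc n) ] detAt s ∎
  where
  open ≡-Reasoning
  a b : Fin (suc n) → ℤ
  a j = F zero j (+ 1)
  b j = F zero j (- + 1)
  Fᵣ : Fin (suc n) → Fin n → Fin n → ℤ → ℤ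
  Fᵣ j r c = F (suc r) (punchIn j c)
  D : Fin (suc n) → Vec ℤ n → ℤ
  D j v = det n (λ r c → Fᵣ j r c (lookup v r))
  detAt : Vec ℤ (suc n) → ℤ
  detAt s = det (suc n) (λ i j → F i j (lookup s i))
  splitFirstRow : ∀ v → ∑[ j < suc n ] (sign (toℕ j) * (a j + b j) * D j v)
                        ≡ ∑ˡ ((+ 1 ∷ v) ∷ (- + 1 ∷ v) ∷ []) detAt
  splitFirstRow v = begin
    ∑[ j < suc n ] (sign (toℕ j) * (a j + b j) * D j v)
      ≡⟨ sum-cong-≗ (λ j → distrib (sign (toℕ j)) (a j) (b j) (D j v)) ⟩
    ∑[ j < suc n ] (sign (toℕ j) * a j * D j v + sign (toℕ j) * b j * D j v)
      ≡⟨ ∑-distrib-+ (λ j → sign (toℕ j) * a j * D j v) (λ j → sign (toℕ j) * b j * D j v) ⟩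
    ∑[ j < suc n ] (sign (toℕ j) * a j * D j v) + ∑[ j < suc n ] (sign (toℕ j) * b j * D j v)
      ≡⟨ cong₂ _+_ (det-expand n (λ i j → F i j (lookup (+ 1 ∷ v) i)))
                   (trans (ℤP.+-identityʳ _) (det-expand n (λ i j → F i j (lookup (- + 1 ∷ v) i)))) ⟨
    detAt (+ 1 ∷ v) + (detAt (- + 1 ∷ v) + + 0) ∎
    where distrib : ∀ s x y d → s * (x + y) * d ≡ s * x * d + s * y * d
          distrib = solve-∀

Decreasing : ∀ {n} → Vec ℤ n → Set
Decreasing [] = ⊤
Decreasing (x ∷ xs) = (∀ i → lookup xs i ℤ.< x) × Decreasing xs

head-maximal : ∀ {n} (v : Vec ℤ (suc n)) → Decreasing v → ∀ i → lookup v i ℤ.≤ V.head v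
head-maximal (x ∷ xs) dec zero = ℤP.≤-refl
head-maximal (x ∷ xs) (xs<x , _) (suc i) = ℤP.<⇒≤ (xs<x i)

δ : ℤ → ℤ → ℤ
δ x y = if does (x ℤ.≟ y) then + 1 else + 0

δ-refl : ∀ x → δ x x ≡ + 1
δ-refl x rewrite dec-true (x ℤ.≟ x) refl = refl

δ-distinct : ∀ {x y} → x ≢ y → δ x y ≡ + 0
δ-distinct {x} {y} x≢y rewrite dec-false (x ℤ.≟ y) x≢y = refl

det-δ-cons : ∀ n x (xs ys : Vec ℤ n) → (∀ i → lookup ys i ℤ.< x) →
  det (suc n) (λ i j → δ (lookup (x ∷ xs) i) (lookup (x ∷ ys) j))
    ≡ det n (λ i j → δ (lookup xs i) (lookup ys j))
det-δ-cons n x xs ys ys<x =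
  trans (det-expand n M)
  (trans (sum-δ n zero {expansionTerm n M} offDiagonal)
  (trans (cong (λ e → + 1 * e * det n (minor M zero)) (δ-refl x)) (ℤP.*-identityˡ _)))
  where
  M : Matrix (suc n)
  M i j = δ (lookup (x ∷ xs) i) (lookup (x ∷ ys) j)
  offDiagonal : ∀ j → j ≢ zero → expansionTerm n M j ≡ + 0
  offDiagonal zero 0≢0 = ⊥-elim (0≢0 refl)
  offDiagonal (suc j) _ = expansionTerm-zero n M (suc j) (δ-distinct (λ x≡yⱼ → ℤP.<-irrefl (sym x≡yⱼ) (ys<x j)))

det-δ-self : ∀ n (p : Vec ℤ n) → Decreasing p → det n (λ i j → δ (lookup p i) (lookup p j)) ≡ + 1
det-δ-self zero [] _ = refl
det-δ-self (suc n) (x ∷ xs) (xs<x , dec) = trans (det-δ-cons n x xs xs xs<x) (det-δ-self n xs dec)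

det-δ-distinct : ∀ n (p q : Vec ℤ n) → Decreasing p → Decreasing q → p ≢ q →
  det n (λ i j → δ (lookup p i) (lookup q j)) ≡ + 0
det-δ-distinct zero [] [] _ _ p≢q = ⊥-elim (p≢q refl)
det-δ-distinct (suc n) (x ∷ xs) (y ∷ ys) decp@(_ , decxs) decq@(ys<y , decys) p≢q with ℤP.<-cmp x y
... | tri≈ _ refl _ = trans (det-δ-cons n x xs ys ys<y)
                            (det-δ-distinct n xs ys decxs decys (p≢q ∘ cong (x ∷_)))
... | tri> _ _ y<x = det-zeroRow (suc n) (λ i j → δ (lookup (x ∷ xs) i) (lookup (y ∷ ys) j)) zero (λ j →
        δ-distinct (λ x≡qⱼ → ℤP.<-irrefl (sym x≡qⱼ)
                                          (ℤP.≤-<-trans (head-maximal (y ∷ ys) decq j) y<x)))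
... | tri< x<y _ _ = det-zeroColumn (suc n) (λ i j → δ (lookup (x ∷ xs) i) (lookup (y ∷ ys) j)) zero (λ i →
        δ-distinct (λ pᵢ≡y → ℤP.<-irrefl pᵢ≡y (ℤP.≤-<-trans (head-maximal (x ∷ xs) decp i) x<y)))

δ-support : ∀ {x y} → δ x y ≢ + 0 → x ≡ y
δ-support {x} {y} δ≢0 with x ℤ.≟ y
... | yes x≡y = x≡y
... | no _ = ⊥-elim (δ≢0 refl)

δ-difference : ∀ x y → δ (y - x) (+ 0) ≡ δ x y
δ-difference x y with x ℤ.≟ y
... | yes refl = cong (λ z → δ z (+ 0)) (ℤP.+-inverseʳ x)
... | no x≢y = δ-distinct (x≢y ∘ sym ∘ ℤP.i-j≡0⇒i≡j y x)

-- Binomial coefficients at half-integers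

halfBinom-negative : ∀ k {N} → N ℤ.< + 0 → halfBinom k N ≡ + 0
halfBinom-negative k { -[1+ _ ]} _ = refl
halfBinom-negative k {+ _} (ℤ.+<+ ())

halfBinom-large : ∀ k b → 2 ℕ.* k ℕ.< b → halfBinom k (+ b) ≡ + 0
halfBinom-large k b 2k<b with ℕ._≟_ (b ℕ.% 2) 0
... | no _ = refl
... | yes b%2≡0 = cong +_ (k>n⇒nCk≡0 k<b/2)
  where
  b≡b/2*2 : b ≡ b ℕ./ 2 ℕ.* 2
  b≡b/2*2 = trans (ℕD.m≡m%n+[m/n]*n b 2) (cong (ℕ._+ b ℕ./ 2 ℕ.* 2) b%2≡0)
  k<b/2 : k ℕ.< b ℕ./ 2
  k<b/2 = ℕP.*-cancelʳ-< 2 k (b ℕ./ 2)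
            (subst (k ℕ.* 2 ℕ.<_) b≡b/2*2 (subst (ℕ._< b) (ℕP.*-comm 2 k) 2k<b))

halfBinom-outside : ∀ k N → k ℕ.< ℤ.∣ N - + k ∣ → halfBinom k N ≡ + 0
halfBinom-outside k N k<d with ℤP.+∣i∣≡i⊎+∣i∣≡-i (N - + k)
... | inj₁ d≡N-k = subst (λ M → halfBinom k M ≡ + 0) N≡k+d (halfBinom-large k (k ℕ.+ d) 2k<k+d)
  where
  d = ℤ.∣ N - + k ∣
  N≡k+d : + (k ℕ.+ d) ≡ N
  N≡k+d = trans (ℤP.pos-+ k d) (trans (cong (_+_ (+ k)) d≡N-k) (cancel (+ k) N))
    where cancel : ∀ k N → k + (N - k) ≡ N
          cancel = solve-∀
  2k<k+d : 2 ℕ.* k ℕ.< k ℕ.+ d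
  2k<k+d = subst (ℕ._< k ℕ.+ d) (cong (k ℕ.+_) (sym (ℕP.+-identityʳ k))) (ℕP.+-monoʳ-< k k<d)
... | inj₂ d≡k-N = halfBinom-negative k N<0
  where
  d = ℤ.∣ N - + k ∣
  N≡k-d : + k - + d ≡ N
  N≡k-d = trans (cong (_-_ (+ k)) d≡k-N) (cancel (+ k) N)
    where cancel : ∀ k N → k - - (N - k) ≡ N
          cancel = solve-∀
  N<0 : N ℤ.< + 0
  N<0 = subst₂ ℤ._<_ N≡k-d (ℤP.+-inverseʳ (+ d)) (ℤP.+-monoˡ-< (- + d) (ℤ.+<+ k<d))

halfBinom-far : ∀ k D c x X → 1 ℕ.≤ c → ℤ.∣ X ∣ ℕ.≤ D → k ℕ.+ D ℕ.+ 1 ℕ.≤ ℤ.∣ x ∣ →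
  halfBinom k (+ k + + c * x + X) ≡ + 0
halfBinom-far k D (suc c) x X _ ∣X∣≤D far = halfBinom-outside k (+ k + cx + X)
  (subst (λ z → k ℕ.< ℤ.∣ z ∣) (sym (cancel (+ k) cx X)) k<∣cx+X∣)
  where
  open ℕP.≤-Reasoning
  cx = + suc c * x
  cancel : ∀ k y X → k + y + X - k ≡ y + X
  cancel = solve-∀
  ∣x∣≤∣cx∣ : ℤ.∣ x ∣ ℕ.≤ ℤ.∣ cx ∣
  ∣x∣≤∣cx∣ = subst (ℤ.∣ x ∣ ℕ.≤_) (sym (ℤP.abs-* (+ suc c) x)) (ℕP.m≤n*m ℤ.∣ x ∣ (suc c))
  k<∣cx+X∣ : k ℕ.< ℤ.∣ cx + X ∣
  k<∣cx+X∣ = ℕP.+-cancelʳ-< D k ℤ.∣ cx + X ∣ (begin-strict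
    k ℕ.+ D                       <⟨ ℕP.n<1+n (k ℕ.+ D) ⟩
    suc (k ℕ.+ D)                 ≡⟨ ℕP.+-comm 1 (k ℕ.+ D) ⟩
    k ℕ.+ D ℕ.+ 1                 ≤⟨ ℕP.≤-trans far ∣x∣≤∣cx∣ ⟩
    ℤ.∣ cx ∣                      ≡⟨ cong ℤ.∣_∣ (addSub cx X) ⟨
    ℤ.∣ cx + X - X ∣              ≤⟨ ℤP.∣i-j∣≤∣i∣+∣j∣ (cx + X) X ⟩
    ℤ.∣ cx + X ∣ ℕ.+ ℤ.∣ X ∣      ≤⟨ ℕP.+-monoʳ-≤ ℤ.∣ cx + X ∣ ∣X∣≤D ⟩
    ℤ.∣ cx + X ∣ ℕ.+ D            ∎)
    where addSub : ∀ y X → y + X - X ≡ y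
          addSub = solve-∀

halfBinom-zero : ∀ N → halfBinom 0 N ≡ δ N (+ 0)
halfBinom-zero (+ zero) = refl
halfBinom-zero (+ suc a) =
  trans (halfBinom-large 0 (suc a) (ℕ.s≤s ℕ.z≤n)) (sym (δ-distinct {+ suc a} {+ 0} (λ ())))
halfBinom-zero -[1+ a ] = refl

halfBinom-pascal : ∀ k N → halfBinom (suc k) N ≡ halfBinom k (N - + 2) + halfBinom k N
halfBinom-pascal k (+ zero) = refl
halfBinom-pascal k (+ suc zero) = refl
halfBinom-pascal k (+ suc (suc a)) with ℕ._≟_ (a ℕ.% 2) 0
... | yes _ = cong +_ (begin
    suc k C (suc (suc a) ℕ./ 2)           ≡⟨ cong (suc k C_) a+2/2≡a/2+1 ⟩
    suc k C suc (a ℕ./ 2)                 ≡⟨ nCk+nC[k+1]≡[n+1]C[k+1] k (a ℕ./ 2) ⟨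
    k C (a ℕ./ 2) ℕ.+ k C suc (a ℕ./ 2)   ≡⟨ cong (λ c → k C (a ℕ./ 2) ℕ.+ k C c) a+2/2≡a/2+1 ⟨
    k C (a ℕ./ 2) ℕ.+ k C (suc (suc a) ℕ./ 2) ∎)
  where
  open ≡-Reasoning
  a+2/2≡a/2+1 : suc (suc a) ℕ./ 2 ≡ suc (a ℕ./ 2)
  a+2/2≡a/2+1 = ℕD.m/n≡1+[m∸n]/n {suc (suc a)} {2} (ℕ.s≤s (ℕ.s≤s ℕ.z≤n))
... | no _ = refl
halfBinom-pascal k -[1+ a ] = refl

-- Sums over boxes of lattice points

IsUnit : ℤ → Set
IsUnit s = s ≡ + 1 ⊎ s ≡ - + 1

∑-upTo-suc : ∀ N (φ : ℕ → ℤ) → ∑[ a ∈ upTo (suc N) ] φ a ≡ φ 0 + ∑[ a ∈ upTo N ] φ (suc a)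
∑-upTo-suc N φ = cong (_+_ (φ 0)) (trans (cong (λ xs → ∑ˡ xs φ) (sym (LP.map-applyUpTo id suc N)))
                                          (∑ˡ-map (upTo N) suc φ))

∑-upTo-telescope : ∀ N (φ : ℕ → ℤ) →
                   ∑[ a ∈ upTo N ] φ (suc a) + φ 0 ≡ ∑[ a ∈ upTo N ] φ a + φ N
∑-upTo-telescope N φ = begin
  ∑[ a ∈ upTo N ] φ (suc a) + φ 0 ≡⟨ ℤP.+-comm _ (φ 0) ⟩
  φ 0 + ∑[ a ∈ upTo N ] φ (suc a) ≡⟨ ∑-upTo-suc N φ ⟨
  ∑ˡ (upTo (suc N)) φ             ≡⟨ cong (λ xs → ∑ˡ xs φ) (LP.upTo-∷ʳ N) ⟨
  ∑ˡ (upTo N ++ N ∷ []) φ         ≡⟨ ∑ˡ-++ (upTo N) (N ∷ []) φ ⟩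
  ∑ˡ (upTo N) φ + (φ N + + 0)     ≡⟨ cong (_+_ (∑ˡ (upTo N) φ)) (ℤP.+-identityʳ (φ N)) ⟩
  ∑ˡ (upTo N) φ + φ N             ∎
  where open ≡-Reasoning

∑-upTo-δ : ∀ N (φ : ℕ → ℤ) {b} → b ℕ.< N → (∀ a → a ≢ b → φ a ≡ + 0) →
           ∑[ a ∈ upTo N ] φ a ≡ φ b
∑-upTo-δ (suc N) φ {zero} _ φ≗0 =
  trans (∑-upTo-suc N φ) (trans (cong (_+_ (φ 0)) (∑ˡ-zero (upTo N) (λ a → φ≗0 (suc a) (λ ()))))
                                (ℤP.+-identityʳ (φ 0)))
∑-upTo-δ (suc N) φ {suc b} b<N φ≗0 =
  trans (∑-upTo-suc N φ) (trans (cong (_+ ∑[ a ∈ upTo N ] φ (suc a)) (φ≗0 0 (λ ())))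
        (trans (ℤP.+-identityˡ _)
               (∑-upTo-δ N (φ ∘ suc) (ℕP.≤-pred b<N) (λ a a≢b → φ≗0 (suc a) (a≢b ∘ ℕP.suc-injective)))))

interval : ℕ → List ℤ
interval B = L.map (λ a → + a - + B) (upTo (suc (2 ℕ.* B)))

VanishesOutside : ℕ → (ℤ → ℤ) → Set
VanishesOutside B g = ∀ x → B ℕ.≤ ℤ.∣ x ∣ → g x ≡ + 0

interval-telescope : ∀ B (g : ℤ → ℤ) →
  ∑[ x ∈ interval B ] g (x + + 1) + g (- + B) ≡ ∑[ x ∈ interval B ] g x + g (+ suc B)
interval-telescope B g = begin
  ∑[ x ∈ interval B ] g (x + + 1) + g (- + B)
    ≡⟨ cong₂ _+_ (trans (∑ˡ-map (upTo N) _ (λ x → g (x + + 1)))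
                        (∑ˡ-cong (upTo N) (λ a → cong g (shiftIndex (+ a) (+ B)))))
                 (cong g (sym (ℤP.+-identityˡ (- + B)))) ⟩
  ∑[ a ∈ upTo N ] φ (suc a) + φ 0
    ≡⟨ ∑-upTo-telescope N φ ⟩
  ∑[ a ∈ upTo N ] φ a + φ N
    ≡⟨ cong₂ _+_ (sym (∑ˡ-map (upTo N) _ g)) (cong g top) ⟩
  ∑[ x ∈ interval B ] g x + g (+ suc B) ∎
  where
  open ≡-Reasoning
  N = suc (2 ℕ.* B)
  φ : ℕ → ℤ
  φ a = g (+ a - + B)
  shiftIndex : ∀ a b → a - b + + 1 ≡ + 1 + a - b
  shiftIndex = solve-∀
  top : + N - + B ≡ + suc B
  top = trans (cong (λ z → + suc z - + B) (cong (B ℕ.+_) (ℕP.+-identityʳ B)))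
              (trans (cong (_- + B) (ℤP.pos-+ (suc B) B)) (cancel (+ suc B) (+ B)))
    where cancel : ∀ a b → a + b - b ≡ a
          cancel = solve-∀

interval-shift : ∀ B (g : ℤ → ℤ) → VanishesOutside B g → ∀ {s} → IsUnit s →
  ∑[ x ∈ interval B ] g (x + s) ≡ ∑[ x ∈ interval B ] g x
interval-shift B g g≈0 (inj₁ refl) = begin
  ∑[ x ∈ interval B ] g (x + + 1)               ≡⟨ ℤP.+-identityʳ _ ⟨
  ∑[ x ∈ interval B ] g (x + + 1) + + 0         ≡⟨ cong (_+_ (∑[ x ∈ interval B ] g (x + + 1))) bottom ⟨
  ∑[ x ∈ interval B ] g (x + + 1) + g (- + B)   ≡⟨ interval-telescope B g ⟩
  ∑[ x ∈ interval B ] g x + g (+ suc B)         ≡⟨ cong (_+_ (∑[ x ∈ interval B ] g x)) top ⟩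
  ∑[ x ∈ interval B ] g x + + 0                 ≡⟨ ℤP.+-identityʳ _ ⟩
  ∑[ x ∈ interval B ] g x                       ∎
  where
  open ≡-Reasoning
  bottom : g (- + B) ≡ + 0
  bottom = g≈0 (- + B) (ℕP.≤-reflexive (sym (ℤP.∣-i∣≡∣i∣ (+ B))))
  top : g (+ suc B) ≡ + 0
  top = g≈0 (+ suc B) (ℕP.n≤1+n B)
interval-shift B g g≈0 (inj₂ refl) = begin
  ∑[ x ∈ interval B ] g (x - + 1)                         ≡⟨ ℤP.+-identityʳ _ ⟨
  ∑[ x ∈ interval B ] g (x - + 1) + + 0                   ≡⟨ cong (_+_ (∑[ x ∈ interval B ] g (x - + 1))) top ⟨
  ∑[ x ∈ interval B ] g (x - + 1) + g (+ suc B - + 1)     ≡⟨ interval-telescope B (λ x → g (x - + 1)) ⟨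
  ∑[ x ∈ interval B ] g (x + + 1 - + 1) + g (- + B - + 1) ≡⟨ cong₂ _+_ (∑ˡ-cong (interval B) (cong g ∘ subAdd)) bottom ⟩
  ∑[ x ∈ interval B ] g x + + 0                           ≡⟨ ℤP.+-identityʳ _ ⟩
  ∑[ x ∈ interval B ] g x                                 ∎
  where
  open ≡-Reasoning
  subAdd : ∀ x → x + + 1 - + 1 ≡ x
  subAdd = solve-∀
  addSub : ∀ x → + 1 + x - + 1 ≡ x
  addSub = solve-∀
  belowInterval : ∀ x → - x - + 1 ≡ - (+ 1 + x)
  belowInterval = solve-∀
  top : g (+ suc B - + 1) ≡ + 0
  top = trans (cong g (addSub (+ B))) (g≈0 (+ B) ℕP.≤-refl)
  bottom : g (- + B - + 1) ≡ + 0
  bottom = g≈0 (- + B - + 1)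
             (ℕP.≤-trans (ℕP.n≤1+n B) (ℕP.≤-reflexive (cong ℤ.∣_∣ (sym (belowInterval (+ B))))))

interval-δ : ∀ B (g : ℤ → ℤ) → (∀ x → x ≢ + 0 → g x ≡ + 0) →
             ∑[ x ∈ interval B ] g x ≡ g (+ 0)
interval-δ B g g≈0 = trans (∑ˡ-map (upTo (suc (2 ℕ.* B))) _ g)
  (trans (∑-upTo-δ (suc (2 ℕ.* B)) (λ a → g (+ a - + B)) (ℕ.s≤s (ℕP.m≤m+n B (B ℕ.+ 0)))
            (λ a a≢B → g≈0 _ (a≢B ∘ ℤP.+-injective ∘ ℤP.i-j≡0⇒i≡j (+ a) (+ B))))
         (cong g (ℤP.+-inverseʳ (+ B))))

∑-box-cons : ∀ B n (f : Vec ℤ (suc n) → ℤ) →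
  ∑[ t ∈ box B (suc n) ] f t ≡ ∑[ v ∈ box B n ] ∑[ x ∈ interval B ] f (x ∷ v)
∑-box-cons B n f = trans (∑ˡ-concatMap (box B n) _ f) (∑ˡ-cong (box B n) (λ v →
  trans (∑ˡ-map (upTo (suc (2 ℕ.* B))) _ f) (sym (∑ˡ-map (upTo (suc (2 ℕ.* B))) _ (λ x → f (x ∷ v))))))

∑-box-head : ∀ B n (f : Vec ℤ (suc n) → ℤ) →
  ∑[ t ∈ box B (suc n) ] f t ≡ ∑[ x ∈ interval B ] ∑[ v ∈ box B n ] f (x ∷ v)
∑-box-head B n f = trans (∑-box-cons B n f) (∑ˡ-comm (box B n) (interval B) (λ v x → f (x ∷ v)))

transposeVec : ∀ {A : Set} {n} → Fin n → Fin n → Vec A n → Vec A n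
transposeVec i j t = V.tabulate (λ r → lookup t (transpose i j r))

∑-box-transpose : ∀ B n (f : Vec ℤ n → ℤ) {i j : Fin n} → i ≢ j →
  ∑[ t ∈ box B n ] f (transposeVec i j t) ≡ ∑[ t ∈ box B n ] f t
∑-box-transpose B n f {i} {j} i≢j =
  transposition-induction Invariant invariant-01 invariant-suc invariant-sym invariant-conj i j i≢j f
  where
  Invariant : ∀ {n} → Fin n → Fin n → Set
  Invariant {n} i j = ∀ f → ∑[ t ∈ box B n ] f (transposeVec i j t) ≡ ∑[ t ∈ box B n ] f t

  invariant-01 : ∀ {n} → Invariant {suc (suc n)} zero (suc zero)
  invariant-01 {n} f = begin
    ∑[ t ∈ box B (suc (suc n)) ] f (transposeVec zero (suc zero) t)
      ≡⟨ consTwice (λ t → f (transposeVec zero (suc zero) t)) ⟩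
    ∑[ v ∈ box B n ] ∑[ x ∈ interval B ] ∑[ y ∈ interval B ]
      f (transposeVec zero (suc zero) (y ∷ x ∷ v))
      ≡⟨ ∑ˡ-cong (box B n) (λ v → trans (∑ˡ-cong (interval B) (λ x → ∑ˡ-cong (interval B) (λ y →
           cong (λ w → f (x ∷ y ∷ w)) (VP.tabulate∘lookup v))))
           (∑ˡ-comm (interval B) (interval B) (λ x y → f (x ∷ y ∷ v)))) ⟩
    ∑[ v ∈ box B n ] ∑[ y ∈ interval B ] ∑[ x ∈ interval B ] f (x ∷ y ∷ v)
      ≡⟨ consTwice f ⟨
    ∑[ t ∈ box B (suc (suc n)) ] f t ∎
    where
    open ≡-Reasoning
    consTwice : ∀ F → ∑[ t ∈ box B (suc (suc n)) ] F t
                      ≡ ∑[ v ∈ box B n ] ∑[ x ∈ interval B ] ∑[ y ∈ interval B ] F (y ∷ x ∷ v)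
    consTwice F = trans (∑-box-cons B (suc n) F) (∑-box-cons B n (λ w → ∑[ y ∈ interval B ] F (y ∷ w)))

  invariant-suc : ∀ {n} {i j : Fin n} → Invariant i j → Invariant (suc i) (suc j)
  invariant-suc {n} {i} {j} inv f = begin
    ∑[ t ∈ box B (suc n) ] f (transposeVec (suc i) (suc j) t)
      ≡⟨ ∑-box-head B n _ ⟩
    ∑[ x ∈ interval B ] ∑[ v ∈ box B n ] f (transposeVec (suc i) (suc j) (x ∷ v))
      ≡⟨ ∑ˡ-cong (interval B) (λ x → trans (∑ˡ-cong (box B n) (λ v →
           cong (λ w → f (x ∷ w)) (VP.tabulate-cong (λ r → cong (lookup (x ∷ v)) (transpose-suc i j r)))))
           (inv (λ w → f (x ∷ w)))) ⟩
    ∑[ x ∈ interval B ] ∑[ v ∈ box B n ] f (x ∷ v)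
      ≡⟨ ∑-box-head B n f ⟨
    ∑[ t ∈ box B (suc n) ] f t ∎
    where open ≡-Reasoning

  invariant-sym : ∀ {n} {i j : Fin n} → Invariant i j → Invariant j i
  invariant-sym {n} {i} {j} inv f =
    trans (∑ˡ-cong (box B n) (λ t → cong f (VP.tabulate-cong (λ r → cong (lookup t) (transpose-comm j i r)))))
          (inv f)

  invariant-conj : ∀ {n} {j : Fin (suc n)} → Invariant (suc zero) (suc (suc j)) →
                   Invariant {suc (suc (suc n))} zero (suc zero) → Invariant zero (suc (suc j))
  invariant-conj {n} {j} inv₁ inv₀₁ f = begin
    ∑[ t ∈ box B N ] f (transposeVec zero (suc (suc j)) t)
      ≡⟨ ∑ˡ-cong (box B N) (λ t → cong f (conj t)) ⟩
    ∑[ t ∈ box B N ] f (transposeVec i₁ j₁ (transposeVec zero (suc zero) (transposeVec i₁ j₁ t)))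
      ≡⟨ inv₁ (λ t → f (transposeVec i₁ j₁ (transposeVec zero (suc zero) t))) ⟩
    ∑[ t ∈ box B N ] f (transposeVec i₁ j₁ (transposeVec zero (suc zero) t))
      ≡⟨ inv₀₁ (λ t → f (transposeVec i₁ j₁ t)) ⟩
    ∑[ t ∈ box B N ] f (transposeVec i₁ j₁ t)
      ≡⟨ inv₁ f ⟩
    ∑[ t ∈ box B N ] f t ∎
    where
    open ≡-Reasoning
    N = suc (suc (suc n))
    i₁ j₁ : Fin N
    i₁ = suc zero
    j₁ = suc (suc j)
    t₀₁ : Fin N → Fin N
    t₀₁ = transpose zero (suc zero)
    conj : ∀ t → transposeVec zero (suc (suc j)) t
               ≡ transposeVec i₁ j₁ (transposeVec zero (suc zero) (transposeVec i₁ j₁ t))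
    conj t = VP.tabulate-cong (λ r → trans (cong (lookup t) (transpose-conj j r))
      (sym (trans (VP.lookup∘tabulate (lookup (transposeVec i₁ j₁ t) ∘ t₀₁) (transpose i₁ j₁ r))
                  (VP.lookup∘tabulate (lookup t ∘ transpose i₁ j₁) (t₀₁ (transpose i₁ j₁ r))))))

∑-box-shift : ∀ B n (i : Fin n) (g : Vec ℤ n → ℤ) → (∀ t → B ℕ.≤ ℤ.∣ lookup t i ∣ → g t ≡ + 0) →
  ∀ {s} → IsUnit s → ∑[ t ∈ box B n ] g (updateAt t i (_+ s)) ≡ ∑[ t ∈ box B n ] g t
∑-box-shift B (suc n) zero g g≈0 unit = trans (∑-box-cons B n _) (trans
  (∑ˡ-cong (box B n) (λ v → interval-shift B (λ x → g (x ∷ v)) (λ x → g≈0 (x ∷ v)) unit))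
  (sym (∑-box-cons B n g)))
∑-box-shift B (suc n) (suc i) g g≈0 unit = trans (∑-box-head B n _) (trans
  (∑ˡ-cong (interval B) (λ x → ∑-box-shift B n i (λ v → g (x ∷ v)) (λ v → g≈0 (x ∷ v)) unit))
  (sym (∑-box-head B n g)))

zeros : ∀ n → Vec ℤ n
zeros n = V.replicate n (+ 0)

∑-box-δ : ∀ B n (g : Vec ℤ n → ℤ) → (∀ t → t ≢ zeros n → g t ≡ + 0) →
          ∑[ t ∈ box B n ] g t ≡ g (zeros n)
∑-box-δ B zero g g≈0 = ℤP.+-identityʳ (g [])
∑-box-δ B (suc n) g g≈0 = trans (∑-box-cons B n g) (trans
  (∑ˡ-cong (box B n) (λ v → interval-δ B (λ x → g (x ∷ v))
                                        (λ x x≢0 → g≈0 (x ∷ v) (x≢0 ∘ cong V.head))))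
  (∑-box-δ B n (λ v → g (+ 0 ∷ v)) (λ v v≢0 → g≈0 (+ 0 ∷ v) (v≢0 ∘ cong V.tail))))

vsum-lookup : ∀ {n} (t : Vec ℤ n) → vsum t ≡ sum (lookup t)
vsum-lookup [] = refl
vsum-lookup (x ∷ t) = cong (_+_ x) (vsum-lookup t)

vsum-transposeVec : ∀ {n} (i j : Fin n) (t : Vec ℤ n) → vsum (transposeVec i j t) ≡ vsum t
vsum-transposeVec i j t = begin
  vsum (transposeVec i j t)         ≡⟨ vsum-lookup (transposeVec i j t) ⟩
  sum (lookup (transposeVec i j t)) ≡⟨ sum-cong-≗ (VP.lookup∘tabulate (lookup t ∘ transpose i j)) ⟩
  sum (lookup t ∘ transpose i j)    ≡⟨ ∑-permute (lookup t) (Perm.transpose i j) ⟨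
  sum (lookup t)                    ≡⟨ vsum-lookup t ⟨
  vsum t                            ∎
  where open ≡-Reasoning

vsum-updateAt : ∀ {n} (t : Vec ℤ n) i d → vsum (updateAt t i (_+ d)) ≡ vsum t + d
vsum-updateAt (x ∷ t) zero d = rearrange x d (vsum t)
  where rearrange : ∀ x d s → x + d + s ≡ x + s + d
        rearrange = solve-∀
vsum-updateAt (x ∷ t) (suc i) d = trans (cong (_+_ x) (vsum-updateAt t i d)) (sym (ℤP.+-assoc x (vsum t) d))

vsum-zeros : ∀ n → vsum (zeros n) ≡ + 0
vsum-zeros zero = refl
vsum-zeros (suc n) = trans (ℤP.+-identityˡ _) (vsum-zeros n)

vsum-nonpositive : ∀ {n} (t : Vec ℤ n) → (∀ i → lookup t i ℤ.≤ + 0) → vsum t ℤ.≤ + 0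
vsum-nonpositive [] _ = ℤP.≤-refl
vsum-nonpositive (x ∷ t) t≤0 = ℤP.+-mono-≤ (t≤0 zero) (vsum-nonpositive t (t≤0 ∘ suc))

nonpositive-vsum-zero : ∀ {n} (t : Vec ℤ n) → (∀ i → lookup t i ℤ.≤ + 0) → vsum t ≡ + 0 →
                        t ≡ zeros n
nonpositive-vsum-zero [] _ _ = refl
nonpositive-vsum-zero (x ∷ t) t≤0 x+s≡0 = cong₂ _∷_ x≡0 (nonpositive-vsum-zero t (t≤0 ∘ suc) s≡0)
  where
  s≤0 : vsum t ℤ.≤ + 0
  s≤0 = vsum-nonpositive t (t≤0 ∘ suc)
  x≡0 : x ≡ + 0
  x≡0 = ℤP.≤-antisym (t≤0 zero)
          (subst₂ ℤ._≤_ x+s≡0 (ℤP.+-identityʳ x) (ℤP.+-monoʳ-≤ x s≤0))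
  s≡0 : vsum t ≡ + 0
  s≡0 = trans (sym (ℤP.+-identityˡ (vsum t))) (trans (cong (_+ vsum t) (sym x≡0)) x+s≡0)

positive-coordinate : ∀ {n} (t : Vec ℤ n) → vsum t ≡ + 0 → t ≢ zeros n → ∃[ i ] + 0 ℤ.< lookup t i
positive-coordinate t sum≡0 t≢0 with FP.any? (λ i → + 0 ℤ.<? lookup t i)
... | yes found = found
... | no none = ⊥-elim (t≢0 (nonpositive-vsum-zero t (λ i → ℤP.≮⇒≥ (none ∘ (i ,_))) sum≡0))

vsum-neg : ∀ {n} (t : Vec ℤ n) → vsum (V.map (-_) t) ≡ - vsum t
vsum-neg [] = refl
vsum-neg (x ∷ t) = trans (cong (_+_ (- x)) (vsum-neg t)) (sym (ℤP.neg-distrib-+ x (vsum t)))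

negative-coordinate : ∀ {n} (t : Vec ℤ n) → vsum t ≡ + 0 → t ≢ zeros n → ∃[ j ] lookup t j ℤ.< + 0
negative-coordinate {n} t sum≡0 t≢0 =
  negate (positive-coordinate (V.map (-_) t) (trans (vsum-neg t) (cong -_ sum≡0)) (t≢0 ∘ negation-zero))
  where
  negate : ∃[ j ] + 0 ℤ.< lookup (V.map (-_) t) j → ∃[ j ] lookup t j ℤ.< + 0
  negate (j , 0<-tⱼ) = j , subst₂ ℤ._<_ (ℤP.neg-involutive (lookup t j)) refl
                             (ℤP.neg-mono-< (subst (+ 0 ℤ.<_) (VP.lookup-map j (-_) t) 0<-tⱼ))
  negation-zero : V.map (-_) t ≡ zeros n → t ≡ zeros n
  negation-zero -t≡0 = begin
    t                      ≡⟨ VP.map-id t ⟨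
    V.map id t             ≡⟨ VP.map-cong ℤP.neg-involutive t ⟨
    V.map (-_ ∘ -_) t      ≡⟨ VP.map-∘ (-_) (-_) t ⟩
    V.map (-_) (V.map (-_) t)  ≡⟨ cong (V.map (-_)) -t≡0 ⟩
    V.map (-_) (zeros n)     ≡⟨ VP.map-replicate (-_) (+ 0) n ⟩
    zeros n                ∎
    where open ≡-Reasoning

-- The alcove and unit steps

isYes≡true⇒ : ∀ {P : Set} (d : Dec P) → ⌊ d ⌋ ≡ true → P
isYes≡true⇒ (yes p) _ = p

isYes≡false⇒¬ : ∀ {P : Set} (d : Dec P) → ⌊ d ⌋ ≡ false → ¬ P
isYes≡false⇒¬ (no ¬p) _ = ¬p

Decreasing-cons : ∀ {n x y} {ys : Vec ℤ n} → y ℤ.< x → Decreasing (y ∷ ys) → Decreasing (x ∷ y ∷ ys)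
Decreasing-cons {x = x} {y} {ys} y<x (ys<y , dec) = below , ys<y , dec
  where
  below : ∀ i → lookup (y ∷ ys) i ℤ.< x
  below zero = y<x
  below (suc i) = ℤP.<-trans (ys<y i) y<x

decreasingᵇ⇒Decreasing : ∀ {n} (v : Vec ℤ n) → decreasingᵇ v ≡ true → Decreasing v
decreasingᵇ⇒Decreasing [] _ = tt
decreasingᵇ⇒Decreasing (x ∷ []) _ = (λ ()) , tt
decreasingᵇ⇒Decreasing (x ∷ y ∷ ys) dec =
  Decreasing-cons (isYes≡true⇒ (y ℤ.<? x) (∧-conicalˡ _ _ dec))
                  (decreasingᵇ⇒Decreasing (y ∷ ys) (∧-conicalʳ _ _ dec))

last≡lookup-fromℕ : ∀ {n} (v : Vec ℤ (suc n)) → V.last v ≡ lookup v (F.fromℕ n)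
last≡lookup-fromℕ (x ∷ []) = refl
last≡lookup-fromℕ (x ∷ y ∷ ys) = last≡lookup-fromℕ (y ∷ ys)

last-minimal : ∀ {n} (v : Vec ℤ (suc n)) → Decreasing v → ∀ i → V.last v ℤ.≤ lookup v i
last-minimal (x ∷ []) _ zero = ℤP.≤-refl
last-minimal (x ∷ y ∷ ys) (y<x , dec) zero =
  ℤP.<⇒≤ (ℤP.≤-<-trans (last-minimal (y ∷ ys) dec zero) (y<x zero))
last-minimal (x ∷ y ∷ ys) (_ , dec) (suc i) = last-minimal (y ∷ ys) dec i


module _ (m : ℕ) where

  InR2⇒Decreasing : ∀ {n} (v : Vec ℤ n) → InR2 m v → Decreasing v
  InR2⇒Decreasing [] _ = tt
  InR2⇒Decreasing (x ∷ xs) inR = decreasingᵇ⇒Decreasing (x ∷ xs) (∧-conicalˡ _ _ inR)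

  InR2⇒width : ∀ {n} (v : Vec ℤ (suc n)) → InR2 m v → V.head v - + (2 ℕ.* m) ℤ.< V.last v
  InR2⇒width (x ∷ xs) inR = isYes≡true⇒ (x - + (2 ℕ.* m) ℤ.<? V.last (x ∷ xs)) (∧-conicalʳ _ _ inR)

  InR2-spread : ∀ {n} (v : Vec ℤ n) → InR2 m v → ∀ a b → lookup v a - lookup v b ℤ.< + (2 ℕ.* m)
  InR2-spread (x ∷ xs) inR a b = begin-strict
    lookup (x ∷ xs) a - lookup (x ∷ xs) b ≤⟨ ℤP.+-mono-≤ (head-maximal (x ∷ xs) dec a)
                                                         (ℤP.neg-mono-≤ (last-minimal (x ∷ xs) dec b)) ⟩
    x - V.last (x ∷ xs)                   <⟨ ℤP.+-monoʳ-< x (ℤP.neg-mono-< (InR2⇒width (x ∷ xs) inR)) ⟩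
    x - (x - + (2 ℕ.* m))                 ≡⟨ cancel x (+ (2 ℕ.* m)) ⟩
    + (2 ℕ.* m)                           ∎
    where
    open ℤP.≤-Reasoning
    dec = InR2⇒Decreasing (x ∷ xs) inR
    cancel : ∀ x c → x - (x - c) ≡ c
    cancel = solve-∀

IsStep : ∀ {n} → Vec ℤ n → Set
IsStep s = ∀ i → IsUnit (lookup s i)

steps-IsStep : ∀ n → All IsStep (steps n)
steps-IsStep zero = (λ ()) ∷ []
steps-IsStep (suc n) =
  concat⁺ (map⁺ (All.map (λ st → cons (inj₁ refl) st ∷ cons (inj₂ refl) st ∷ []) (steps-IsStep n)))
  where
  cons : ∀ {x} {v : Vec ℤ n} → IsUnit x → IsStep v → IsStep (x ∷ v)
  cons unit st zero = unit
  cons unit st (suc i) = st i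

lookup-vadd : ∀ {n} (p s : Vec ℤ n) i → lookup (vadd p s) i ≡ lookup p i + lookup s i
lookup-vadd (x ∷ p) (y ∷ s) zero = refl
lookup-vadd (x ∷ p) (y ∷ s) (suc i) = lookup-vadd p s i

SameParity : ∀ {n} → Vec ℤ n → Set
SameParity p = ∀ i j → + 2 ∣ lookup p i - lookup p j

sameParity⇒SameParity : ∀ {n} (e : Vec ℤ n) → sameParity e → SameParity e
sameParity⇒SameParity e (inj₁ even) i j =
  ∣m∣n⇒∣m-n (∣ᵤ⇒∣ {i = lookup e i} (even i)) (∣ᵤ⇒∣ {i = lookup e j} (even j))
sameParity⇒SameParity e (inj₂ odd) i j = subst (+ 2 ∣_) (cancel (lookup e i) (lookup e j))
  (∣m∣n⇒∣m-n (∣ᵤ⇒∣ {i = lookup e i + + 1} (odd i)) (∣ᵤ⇒∣ {i = lookup e j + + 1} (odd j)))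
  where cancel : ∀ x y → x + + 1 - (y + + 1) ≡ x - y
        cancel = solve-∀

units-differ-evenly : ∀ {a b} → IsUnit a → IsUnit b → + 2 ∣ a - b
units-differ-evenly (inj₁ refl) (inj₁ refl) = divides (+ 0) refl
units-differ-evenly (inj₁ refl) (inj₂ refl) = divides (+ 1) refl
units-differ-evenly (inj₂ refl) (inj₁ refl) = divides (- + 1) refl
units-differ-evenly (inj₂ refl) (inj₂ refl) = divides (+ 0) refl

SameParity-step : ∀ {n} (p s : Vec ℤ n) → SameParity p → IsStep s → SameParity (vadd p s)
SameParity-step p s par step i j rewrite lookup-vadd p s i | lookup-vadd p s j =
  subst (+ 2 ∣_) (rearrange (lookup p i) (lookup p j) (lookup s i) (lookup s j))
        (∣m∣n⇒∣m+n (par i j) (units-differ-evenly (step i) (step j)))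
  where rearrange : ∀ x y a b → x - y + (a - b) ≡ x + a - (y + b)
        rearrange = solve-∀

even-gap : ∀ {d} → + 2 ∣ d → + 0 ℤ.< d → + 2 ℤ.≤ d
even-gap {+ suc k} 2∣d _ = ℤ.+≤+ (ℕ∣.∣⇒≤ (∣⇒∣ᵤ 2∣d))
even-gap {+ zero} _ (ℤ.+<+ ())

unit≤1 : ∀ {a} → IsUnit a → a ℤ.≤ + 1
unit≤1 (inj₁ refl) = ℤP.≤-refl
unit≤1 (inj₂ refl) = ℤ.-≤+

-1≤unit : ∀ {a} → IsUnit a → - + 1 ℤ.≤ a
-1≤unit (inj₁ refl) = ℤ.-≤+
-1≤unit (inj₂ refl) = ℤP.≤-refl

-- Equal parity makes the gap at least 2, which two unit steps can close but not reverse.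
unit-steps-keep-order : ∀ {x y a b} → + 2 ∣ x - y → y ℤ.< x → IsUnit a → IsUnit b → y + b ℤ.≤ x + a
unit-steps-keep-order {x} {y} {a} {b} 2∣x-y y<x unit-a unit-b = begin
  y + b           ≤⟨ ℤP.+-monoʳ-≤ y (unit≤1 unit-b) ⟩
  y + + 1         ≡⟨ addSub y ⟩
  y + + 2 - + 1   ≤⟨ ℤP.+-monoˡ-≤ (- + 1) gap ⟩
  x - + 1         ≤⟨ ℤP.+-monoʳ-≤ x (-1≤unit unit-a) ⟩
  x + a           ∎
  where
  open ℤP.≤-Reasoning
  addSub : ∀ y → y + + 1 ≡ y + + 2 - + 1
  addSub = solve-∀
  cancel : ∀ x y → y + (x - y) ≡ x
  cancel = solve-∀
  0<x-y : + 0 ℤ.< x - y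
  0<x-y = subst (ℤ._< x - y) (ℤP.+-inverseʳ y) (ℤP.+-monoˡ-< (- y) y<x)
  gap : y + + 2 ℤ.≤ x
  gap = subst (y + + 2 ℤ.≤_) (cancel x y) (ℤP.+-monoʳ-≤ y (even-gap 2∣x-y 0<x-y))

Collision : ∀ {n} → Vec ℤ n → Set
Collision q = ∃[ i ] ∃[ j ] i ≢ j × lookup q i ≡ lookup q j

Collision-tail : ∀ {n x} {q : Vec ℤ n} → Collision q → Collision (x ∷ q)
Collision-tail (i , j , i≢j , qᵢ≡qⱼ) = suc i , suc j , i≢j ∘ FP.suc-injective , qᵢ≡qⱼ

decreasing-exit : ∀ {n} (p s : Vec ℤ n) → SameParity p → IsStep s →
  decreasingᵇ p ≡ true → decreasingᵇ (vadd p s) ≡ false → Collision (vadd p s)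
decreasing-exit [] [] _ _ _ ()
decreasing-exit (x ∷ []) (a ∷ []) _ _ _ ()
decreasing-exit (x ∷ y ∷ ys) (a ∷ b ∷ bs) par step decp decq =
  byComparison (y + b ℤ.<? x + a) decq
    (Collision-tail ∘ decreasing-exit (y ∷ ys) (b ∷ bs) (λ i j → par (suc i) (suc j)) (step ∘ suc)
                                      (∧-conicalʳ _ _ decp))
  where
  q = vadd (x ∷ y ∷ ys) (a ∷ b ∷ bs)
  byComparison : (d : Dec (y + b ℤ.< x + a)) → ⌊ d ⌋ ∧ decreasingᵇ (vadd (y ∷ ys) (b ∷ bs)) ≡ false →
                 (decreasingᵇ (vadd (y ∷ ys) (b ∷ bs)) ≡ false → Collision q) → Collision q
  byComparison (yes _) decq′ tailCollision = tailCollision decq′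
  byComparison (no y+b≮x+a) _ _ = zero , suc zero , (λ ()) , ℤP.≤-antisym (ℤP.≮⇒≥ y+b≮x+a)
    (unit-steps-keep-order (par zero (suc zero)) (isYes≡true⇒ (y ℤ.<? x) (∧-conicalˡ _ _ decp))
                           (step zero) (step (suc zero)))

exit-through-wall : ∀ m {n} (p s : Vec ℤ (suc n)) → SameParity p → IsStep s →
                    InR2 m p → inR2ᵇ m (vadd p s) ≡ false →
  Collision (vadd p s) ⊎ lookup (vadd p s) (F.fromℕ n) ≡ lookup (vadd p s) zero - + (2 ℕ.* m)
exit-through-wall m {n} (x ∷ xs) (a ∷ as) par step inp outq with decreasingᵇ (vadd (x ∷ xs) (a ∷ as)) in decq
... | false = inj₁ (decreasing-exit (x ∷ xs) (a ∷ as) par step (∧-conicalˡ _ _ inp) decq)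
... | true = inj₂ (ℤP.≤-antisym lastBelow lastAbove)
  where
  q = vadd (x ∷ xs) (a ∷ as)
  L = F.fromℕ n
  c = + (2 ℕ.* m)
  lastBelow : lookup q L ℤ.≤ x + a - c
  lastBelow = ℤP.≮⇒≥ (isYes≡false⇒¬ (x + a - c ℤ.<? V.last q) outq
                       ∘ subst (x + a - c ℤ.<_) (sym (last≡lookup-fromℕ q)))
  2∣pL-[x-c] : + 2 ∣ lookup (x ∷ xs) L - (x - c)
  2∣pL-[x-c] = subst (+ 2 ∣_) (rearrange (lookup (x ∷ xs) L) x c)
                 (∣m∣n⇒∣m+n (par L zero) (divides (+ m) (trans (cong +_ (ℕP.*-comm 2 m)) (ℤP.pos-* m 2))))
    where rearrange : ∀ y x c → y - x + c ≡ y - (x - c)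
          rearrange = solve-∀
  lastAbove : x + a - c ℤ.≤ lookup q L
  lastAbove = subst₂ ℤ._≤_ (swap x c a) (sym (lookup-vadd (x ∷ xs) (a ∷ as) L))
    (unit-steps-keep-order 2∣pL-[x-c]
                           (subst (x - c ℤ.<_) (last≡lookup-fromℕ (x ∷ xs)) (InR2⇒width m (x ∷ xs) inp))
                           (step L) (step zero))
    where swap : ∀ x c a → x - c + a ≡ x + a - c
          swap = solve-∀

-- The alternating sum

self-negating : ∀ {x : ℤ} → x ≡ - x → x ≡ + 0
self-negating {+ zero} _ = refl
self-negating {+ suc _} ()
self-negating { -[1+ _ ]} ()

module AlternatingSum (n m : ℕ) (l : Vec ℤ n) where

  c : ℤ
  c = + (2 ℕ.* m)

  entry : ℕ → Vec ℤ n → Vec ℤ n → Matrix n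
  entry k p t i j = halfBinom k (+ k + c * lookup t i + lookup l j - lookup p i)

  entry-cong : ∀ k p {t t′} i i′ → c * lookup t′ i′ - lookup p i′ ≡ c * lookup t i - lookup p i →
               ∀ j → entry k p t′ i′ j ≡ entry k p t i j
  entry-cong k p {t} {t′} i i′ eq j = cong (halfBinom k) (begin
    + k + c * lookup t′ i′ + lookup l j - lookup p i′
      ≡⟨ regroup (+ k) (c * lookup t′ i′) (lookup l j) (lookup p i′) ⟩
    + k + (c * lookup t′ i′ - lookup p i′) + lookup l j
      ≡⟨ cong (λ z → + k + z + lookup l j) eq ⟩
    + k + (c * lookup t i - lookup p i) + lookup l j
      ≡⟨ regroup (+ k) (c * lookup t i) (lookup l j) (lookup p i) ⟨
    + k + c * lookup t i + lookup l j - lookup p i ∎)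
    where
    open ≡-Reasoning
    regroup : ∀ k y l p → k + y + l - p ≡ k + (y - p) + l
    regroup = solve-∀

  restricted : ℕ → Vec ℤ n → Vec ℤ n → ℤ
  restricted k p t = if does (vsum t ℤ.≟ + 0) then summand k m p l t else + 0

  alternatingSum : ℕ → ℕ → Vec ℤ n → ℤ
  alternatingSum B k p = ∑[ t ∈ box B n ] restricted k p t

  boxSum≡alternatingSum : ∀ B k p → boxSum B k m p l ≡ alternatingSum B k p
  boxSum≡alternatingSum B k p = ∑ˡ-filter (λ t → vsum t ℤ.≟ + 0) (box B n) (summand k m p l)

  summand-suc : ∀ k p t → summand (suc k) m p l t ≡ ∑[ s ∈ steps n ] summand k m (vadd p s) l t
  summand-suc k p t = begin
    det n (entry (suc k) p t)
      ≡⟨ det-cong n pascal ⟩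
    det n (λ i j → Entry i j (+ 1) + Entry i j (- + 1))
      ≡⟨ det-multilinear-steps n Entry ⟩
    ∑[ s ∈ steps n ] det n (λ i j → Entry i j (lookup s i))
      ≡⟨ ∑ˡ-cong (steps n) (λ s → det-cong n (λ i j →
           cong (λ q → halfBinom k (+ k + c * lookup t i + lookup l j - q)) (sym (lookup-vadd p s i)))) ⟩
    ∑[ s ∈ steps n ] det n (entry k (vadd p s) t) ∎
    where
    open ≡-Reasoning
    Entry : Fin n → Fin n → ℤ → ℤ
    Entry i j σ = halfBinom k (+ k + c * lookup t i + lookup l j - (lookup p i + σ))
    regroup₂ : ∀ K y L P → + 1 + K + y + L - P - + 2 ≡ K + y + L - (P + + 1)
    regroup₂ = solve-∀
    regroup₀ : ∀ K y L P → + 1 + K + y + L - P ≡ K + y + L - (P + - + 1)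
    regroup₀ = solve-∀
    pascal : ∀ i j → entry (suc k) p t i j ≡ Entry i j (+ 1) + Entry i j (- + 1)
    pascal i j = trans (halfBinom-pascal k (+ suc k + c * lookup t i + lookup l j - lookup p i))
      (cong₂ _+_ (cong (halfBinom k) (regroup₂ (+ k) (c * lookup t i) (lookup l j) (lookup p i)))
                 (cong (halfBinom k) (regroup₀ (+ k) (c * lookup t i) (lookup l j) (lookup p i))))

  alternatingSum-suc : ∀ B k p → alternatingSum B (suc k) p ≡ ∑[ s ∈ steps n ] alternatingSum B k (vadd p s)
  alternatingSum-suc B k p =
    trans (∑ˡ-cong (box B n) restricted-suc) (∑ˡ-comm (box B n) (steps n) (λ t s → restricted k (vadd p s) t))
    where
    restricted-suc : ∀ t → restricted (suc k) p t ≡ ∑[ s ∈ steps n ] restricted k (vadd p s) t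
    restricted-suc t with does (vsum t ℤ.≟ + 0)
    ... | true = summand-suc k p t
    ... | false = sym (∑ˡ-zero (steps n) (λ _ → refl))

  Bound : ℕ → Vec ℤ n → Set
  Bound D p = ∀ i j → ℤ.∣ lookup l j - lookup p i ∣ ℕ.≤ D

  summand-far : ∀ k p D → 1 ℕ.≤ m → Bound D p → ∀ t i → k ℕ.+ D ℕ.+ 1 ℕ.≤ ℤ.∣ lookup t i ∣ →
                summand k m p l t ≡ + 0
  summand-far k p D m≥1 bound t i far = det-zeroRow n (entry k p t) i (λ j →
    trans (cong (halfBinom k) (regroup (+ k) (c * lookup t i) (lookup l j) (lookup p i)))
          (halfBinom-far k D (2 ℕ.* m) (lookup t i) (lookup l j - lookup p i)
                         (ℕP.≤-trans m≥1 (ℕP.m≤m+n m (m ℕ.+ 0))) (bound i j) far))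
    where regroup : ∀ K y L P → K + y + L - P ≡ K + y + (L - P)
          regroup = solve-∀

  restricted-far : ∀ k p D B → 1 ℕ.≤ m → Bound D p → k ℕ.+ D ℕ.+ 1 ℕ.≤ B →
                   ∀ t i → B ℕ.≤ ℤ.∣ lookup t i ∣ → restricted k p t ≡ + 0
  restricted-far k p D B m≥1 bound k+D<B t i far with does (vsum t ℤ.≟ + 0)
  ... | true = summand-far k p D m≥1 bound t i (ℕP.≤-trans k+D<B far)
  ... | false = refl

  -- On a wall, a symmetry of the wall acting on t swaps two rows of the determinant,
  -- so the terms cancel in pairs.
  alternatingSum-collision : ∀ B k p {i j} → i ≢ j → lookup p i ≡ lookup p j → alternatingSum B k p ≡ + 0
  alternatingSum-collision B k p {i} {j} i≢j pᵢ≡pⱼ = self-negating (begin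
    alternatingSum B k p                                  ≡⟨ ∑-box-transpose B n (restricted k p) i≢j ⟨
    ∑[ t ∈ box B n ] restricted k p (transposeVec i j t)  ≡⟨ ∑ˡ-cong (box B n) reflected ⟩
    ∑[ t ∈ box B n ] (- restricted k p t)                 ≡⟨ ∑ˡ-neg (box B n) (restricted k p) ⟩
    - alternatingSum B k p                                ∎)
    where
    open ≡-Reasoning
    reflected : ∀ t → restricted k p (transposeVec i j t) ≡ - restricted k p t
    reflected t rewrite vsum-transposeVec i j t with does (vsum t ℤ.≟ + 0)
    ... | false = refl
    ... | true = trans (det-cong n (λ r → entry-cong k p {t} {transposeVec i j t} (transpose i j r) r
                         (cong₂ (λ x y → c * x - y) (VP.lookup∘tabulate (lookup t ∘ transpose i j) r)
                                                    (sym (transpose-respects p pᵢ≡pⱼ r)))))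
                       (det-transpose n (entry k p t) i≢j)

  alternatingSum-affineWall : ∀ B k p D {a L} → a ≢ L → 1 ℕ.≤ m → Bound D p → k ℕ.+ D ℕ.+ 1 ℕ.≤ B →
                              lookup p L ≡ lookup p a - c → alternatingSum B k p ≡ + 0
  alternatingSum-affineWall B k p D {a} {L} a≢L m≥1 bound k+D<B wall = self-negating (begin
    alternatingSum B k p
      ≡⟨ ∑-box-shift B n a (restricted k p) (far) (inj₁ refl) ⟨
    ∑[ t ∈ box B n ] restricted k p (raise t)
      ≡⟨ ∑-box-shift B n L (restricted k p ∘ raise) farAfterRaise (inj₂ refl) ⟨
    ∑[ t ∈ box B n ] restricted k p (raise (lower t))
      ≡⟨ ∑-box-transpose B n (restricted k p ∘ raise ∘ lower) a≢L ⟨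
    ∑[ t ∈ box B n ] restricted k p (reflect t)
      ≡⟨ ∑ˡ-cong (box B n) reflected ⟩
    ∑[ t ∈ box B n ] (- restricted k p t)
      ≡⟨ ∑ˡ-neg (box B n) (restricted k p) ⟩
    - alternatingSum B k p ∎)
    where
    open ≡-Reasoning
    raise lower reflect : Vec ℤ n → Vec ℤ n
    raise t = updateAt t a (_+ + 1)
    lower t = updateAt t L (_+ - + 1)
    reflect t = raise (lower (transposeVec a L t))

    far : ∀ t → B ℕ.≤ ℤ.∣ lookup t a ∣ → restricted k p t ≡ + 0
    far t = restricted-far k p D B m≥1 bound k+D<B t a

    farAfterRaise : ∀ t → B ℕ.≤ ℤ.∣ lookup t L ∣ → restricted k p (raise t) ≡ + 0
    farAfterRaise t big = restricted-far k p D B m≥1 bound k+D<B (raise t) L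
      (subst (λ x → B ℕ.≤ ℤ.∣ x ∣) (sym (VP.lookup∘updateAt′ L a (a≢L ∘ sym) t)) big)

    vsum-reflect : ∀ t → vsum (reflect t) ≡ vsum t
    vsum-reflect t = begin
      vsum (reflect t)                        ≡⟨ vsum-updateAt (lower τt) a (+ 1) ⟩
      vsum (lower τt) + + 1                   ≡⟨ cong (_+ + 1) (vsum-updateAt τt L (- + 1)) ⟩
      vsum τt + - + 1 + + 1                   ≡⟨ cong (λ s → s + - + 1 + + 1) (vsum-transposeVec a L t) ⟩
      vsum t + - + 1 + + 1                    ≡⟨ cancel (vsum t) ⟩
      vsum t                                  ∎
      where
      τt = transposeVec a L t
      cancel : ∀ s → s + - + 1 + + 1 ≡ s
      cancel = solve-∀

    row-reflect : ∀ t r → c * lookup (reflect t) r - lookup p r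
                          ≡ c * lookup t (transpose a L r) - lookup p (transpose a L r)
    row-reflect t r = byCases (r F.≟ a) (r F.≟ L)
      where
      τt = transposeVec a L t
      τt-lookup : ∀ r → lookup τt r ≡ lookup t (transpose a L r)
      τt-lookup = VP.lookup∘tabulate (lookup t ∘ transpose a L)
      raised : ∀ c x P → c * (x + + 1) - P ≡ c * x - (P - c)
      raised = solve-∀
      lowered : ∀ c x P → c * (x + - + 1) - (P - c) ≡ c * x - P
      lowered = solve-∀
      byCases : Dec (r ≡ a) → Dec (r ≡ L) →
                c * lookup (reflect t) r - lookup p r ≡ c * lookup t (transpose a L r) - lookup p (transpose a L r)
      byCases (yes refl) _ = begin
        c * lookup (reflect t) a - lookup p a
          ≡⟨ cong (λ x → c * x - lookup p a) (trans (VP.lookup∘updateAt a (lower τt))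
               (cong (_+ + 1) (trans (VP.lookup∘updateAt′ a L a≢L τt) (τt-lookup a)))) ⟩
        c * (lookup t (transpose a L a) + + 1) - lookup p a
          ≡⟨ trans (raised c (lookup t (transpose a L a)) (lookup p a))
                   (cong (_-_ (c * lookup t (transpose a L a))) (sym wall)) ⟩
        c * lookup t (transpose a L a) - lookup p L
          ≡⟨ cong (λ i → c * lookup t (transpose a L a) - lookup p i) (transpose-matchˡ a L) ⟨
        c * lookup t (transpose a L a) - lookup p (transpose a L a) ∎
      byCases (no r≢a) (yes refl) = begin
        c * lookup (reflect t) L - lookup p L
          ≡⟨ cong₂ (λ x y → c * x - y) (trans (VP.lookup∘updateAt′ L a r≢a (lower τt))
               (trans (VP.lookup∘updateAt L τt) (cong (_+ - + 1) (τt-lookup L)))) wall ⟩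
        c * (lookup t (transpose a L L) + - + 1) - (lookup p a - c)
          ≡⟨ lowered c (lookup t (transpose a L L)) (lookup p a) ⟩
        c * lookup t (transpose a L L) - lookup p a
          ≡⟨ cong (λ i → c * lookup t (transpose a L L) - lookup p i) (transpose-matchʳ a L) ⟨
        c * lookup t (transpose a L L) - lookup p (transpose a L L) ∎
      byCases (no r≢a) (no r≢L) = begin
        c * lookup (reflect t) r - lookup p r
          ≡⟨ cong (λ x → c * x - lookup p r) (trans (VP.lookup∘updateAt′ r a r≢a (lower τt))
               (trans (VP.lookup∘updateAt′ r L r≢L τt) (τt-lookup r))) ⟩
        c * lookup t (transpose a L r) - lookup p r
          ≡⟨ cong (λ i → c * lookup t (transpose a L r) - lookup p i) (transpose-other r≢a r≢L) ⟨
        c * lookup t (transpose a L r) - lookup p (transpose a L r) ∎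

    reflected : ∀ t → restricted k p (reflect t) ≡ - restricted k p t
    reflected t rewrite vsum-reflect t with does (vsum t ℤ.≟ + 0)
    ... | false = refl
    ... | true = trans (det-cong n (λ r → entry-cong k p {t} {reflect t} (transpose a L r) r (row-reflect t r)))
                       (det-transpose n (entry k p t) a≢L)

  entry-origin : ∀ p i j → entry 0 p (zeros n) i j ≡ δ (lookup p i) (lookup l j)
  entry-origin p i j = begin
    halfBinom 0 (+ 0 + c * lookup (zeros n) i + lookup l j - lookup p i)
      ≡⟨ halfBinom-zero (+ 0 + c * lookup (zeros n) i + lookup l j - lookup p i) ⟩
    δ (+ 0 + c * lookup (zeros n) i + lookup l j - lookup p i) (+ 0)
      ≡⟨ cong (λ z → δ (+ 0 + c * z + lookup l j - lookup p i) (+ 0)) (VP.lookup-replicate i (+ 0)) ⟩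
    δ (+ 0 + c * + 0 + lookup l j - lookup p i) (+ 0)
      ≡⟨ cong (λ z → δ z (+ 0)) (simplify c (lookup l j) (lookup p i)) ⟩
    δ (lookup l j - lookup p i) (+ 0)
      ≡⟨ δ-difference (lookup p i) (lookup l j) ⟩
    δ (lookup p i) (lookup l j) ∎
    where
    open ≡-Reasoning
    simplify : ∀ c y x → + 0 + c * + 0 + y - x ≡ y - x
    simplify = solve-∀

  -- For k = 0 an entry in row r and column b is nonzero only if c tᵣ = pᵣ − l_b.  Nonzero entries in a row
  -- with tᵢ ≥ 1 and in a row with tⱼ ≤ −1 would give (pᵢ − pⱼ) + (l_b − lₐ) = c (tᵢ − tⱼ) ≥ 2c, whereas
  -- inside the alcove each of the two differences is below c.
  summand-zero-off-origin : ∀ p → InR2 m p → InR2 m l → ∀ t → vsum t ≡ + 0 → t ≢ zeros n →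
                            summand 0 m p l t ≡ + 0
  summand-zero-off-origin p Rp Rl t sum≡0 t≢0 with summand 0 m p l t ℤ.≟ + 0
  ... | yes det≡0 = det≡0
  ... | no det≢0 = ⊥-elim (ℤP.<-irrefl refl (ℤP.<-≤-trans spread apart))
    where
    positive = positive-coordinate t sum≡0 t≢0
    negative = negative-coordinate t sum≡0 t≢0
    i = proj₁ positive
    j = proj₁ negative
    rowᵢ = det-nonzero⇒row-nonzero n (entry 0 p t) det≢0 i
    rowⱼ = det-nonzero⇒row-nonzero n (entry 0 p t) det≢0 j
    a = proj₁ rowᵢ
    b = proj₁ rowⱼ
    onWall : ∀ r col → entry 0 p t r col ≢ + 0 → + 0 + c * lookup t r + lookup l col - lookup p r ≡ + 0
    onWall r col nonzero =
      δ-support (nonzero ∘ trans (halfBinom-zero (+ 0 + c * lookup t r + lookup l col - lookup p r)))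
    X = (lookup p i - lookup p j) + (lookup l b - lookup l a)
    X≡c[tᵢ-tⱼ] : X ≡ c * (lookup t i - lookup t j)
    X≡c[tᵢ-tⱼ] = begin
      X ≡⟨ expand c (lookup t i) (lookup t j) (lookup l a) (lookup l b) (lookup p i) (lookup p j) ⟩
      c * (lookup t i - lookup t j) - (+ 0 + c * lookup t i + lookup l a - lookup p i)
                                    + (+ 0 + c * lookup t j + lookup l b - lookup p j)
        ≡⟨ cong₂ (λ u v → c * (lookup t i - lookup t j) - u + v)
                 (onWall i a (proj₂ rowᵢ)) (onWall j b (proj₂ rowⱼ)) ⟩
      c * (lookup t i - lookup t j) - + 0 + + 0 ≡⟨ dropZeros _ ⟩
      c * (lookup t i - lookup t j) ∎
      where
      open ≡-Reasoning
      expand : ∀ c tᵢ tⱼ lₐ l_b pᵢ pⱼ → (pᵢ - pⱼ) + (l_b - lₐ) ≡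
               c * (tᵢ - tⱼ) - (+ 0 + c * tᵢ + lₐ - pᵢ) + (+ 0 + c * tⱼ + l_b - pⱼ)
      expand = solve-∀
      dropZeros : ∀ x → x - + 0 + + 0 ≡ x
      dropZeros = solve-∀
    spread : X ℤ.< c + c
    spread = ℤP.+-mono-< (InR2-spread m p Rp i j) (InR2-spread m l Rl b a)
    apart : c + c ℤ.≤ X
    apart = subst₂ ℤ._≤_ (double c) (sym X≡c[tᵢ-tⱼ])
              (ℤP.*-monoˡ-≤-nonNeg c (ℤP.+-mono-≤ (ℤP.i<j⇒suc[i]≤j (proj₂ positive))
                                                  (ℤP.neg-mono-≤ (ℤP.i<j⇒i≤pred[j] (proj₂ negative)))))
      where double : ∀ c → c * + 2 ≡ c + c
            double = solve-∀

  det-δ≡walks₀ : ∀ p → InR2 m p → InR2 m l →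
                 det n (λ i j → δ (lookup p i) (lookup l j)) ≡ + walks 0 m p l
  det-δ≡walks₀ p Rp Rl rewrite Rp with VP.≡-dec ℤ._≟_ p l
  ... | yes refl = det-δ-self n p (InR2⇒Decreasing m p Rp)
  ... | no p≢l = det-δ-distinct n p l (InR2⇒Decreasing m p Rp) (InR2⇒Decreasing m l Rl) p≢l

  alternatingSum-zero : ∀ B p → InR2 m p → InR2 m l → alternatingSum B 0 p ≡ + walks 0 m p l
  alternatingSum-zero B p Rp Rl = begin
    alternatingSum B 0 p                        ≡⟨ ∑-box-δ B n (restricted 0 p) offOrigin ⟩
    restricted 0 p (zeros n)                    ≡⟨ atOrigin ⟩
    det n (entry 0 p (zeros n))                 ≡⟨ det-cong n (entry-origin p) ⟩
    det n (λ i j → δ (lookup p i) (lookup l j)) ≡⟨ det-δ≡walks₀ p Rp Rl ⟩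
    + walks 0 m p l                             ∎
    where
    open ≡-Reasoning
    offOrigin : ∀ t → t ≢ zeros n → restricted 0 p t ≡ + 0
    offOrigin t t≢0 with vsum t ℤ.≟ + 0
    ... | yes sum≡0 = summand-zero-off-origin p Rp Rl t sum≡0 t≢0
    ... | no _ = refl
    atOrigin : restricted 0 p (zeros n) ≡ det n (entry 0 p (zeros n))
    atOrigin rewrite vsum-zeros n = refl

-- Counting walks

walks-outside : ∀ K m {n} (q l : Vec ℤ n) → inR2ᵇ m q ≡ false → walks K m q l ≡ 0
walks-outside zero m q l out rewrite out = refl
walks-outside (suc K) m q l out rewrite out = refl

walks-suc : ∀ k m {n} (p l : Vec ℤ n) → InR2 m p →
            walks (suc k) m p l ≡ sumℕ (L.map (λ s → walks k m (vadd p s) l) (steps n))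
walks-suc k m p l Rp rewrite Rp = refl

sumAbs : ∀ {n} → Vec ℤ n → ℕ
sumAbs = V.foldr _ (λ x s → ℤ.∣ x ∣ ℕ.+ s) 0

∣lookup∣≤sumAbs : ∀ {n} (v : Vec ℤ n) i → ℤ.∣ lookup v i ∣ ℕ.≤ sumAbs v
∣lookup∣≤sumAbs (x ∷ v) zero = ℕP.m≤m+n ℤ.∣ x ∣ (sumAbs v)
∣lookup∣≤sumAbs (x ∷ v) (suc i) = ℕP.≤-trans (∣lookup∣≤sumAbs v i) (ℕP.m≤n+m (sumAbs v) ℤ.∣ x ∣)

module Counting (n m : ℕ) (l : Vec ℤ (suc (suc n))) (m≥1 : 1 ℕ.≤ m) (Rl : InR2 m l) where

  open AlternatingSum (suc (suc n)) m l

  Bound-initial : ∀ p → Bound (sumAbs l ℕ.+ sumAbs p) p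
  Bound-initial p i j = ℕP.≤-trans (ℤP.∣i-j∣≤∣i∣+∣j∣ (lookup l j) (lookup p i))
                                   (ℕP.+-mono-≤ (∣lookup∣≤sumAbs l j) (∣lookup∣≤sumAbs p i))

  Bound-step : ∀ D p s → Bound D p → IsStep s → Bound (suc D) (vadd p s)
  Bound-step D p s bound step i j = begin
    ℤ.∣ lookup l j - lookup (vadd p s) i ∣
      ≡⟨ cong (λ q → ℤ.∣ lookup l j - q ∣) (lookup-vadd p s i) ⟩
    ℤ.∣ lookup l j - (lookup p i + lookup s i) ∣
      ≡⟨ cong ℤ.∣_∣ (regroup (lookup l j) (lookup p i) (lookup s i)) ⟩
    ℤ.∣ lookup l j - lookup p i - lookup s i ∣
      ≤⟨ ℤP.∣i-j∣≤∣i∣+∣j∣ (lookup l j - lookup p i) (lookup s i) ⟩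
    ℤ.∣ lookup l j - lookup p i ∣ ℕ.+ ℤ.∣ lookup s i ∣
      ≤⟨ ℕP.+-mono-≤ (bound i j) (ℕP.≤-reflexive (∣unit∣ (step i))) ⟩
    D ℕ.+ 1
      ≡⟨ ℕP.+-comm D 1 ⟩
    suc D ∎
    where
    open ℕP.≤-Reasoning
    regroup : ∀ y x s → y - (x + s) ≡ y - x - s
    regroup = solve-∀
    ∣unit∣ : ∀ {s} → IsUnit s → ℤ.∣ s ∣ ≡ 1
    ∣unit∣ (inj₁ refl) = refl
    ∣unit∣ (inj₂ refl) = refl

  -- D bounds the distance from p to l; it grows by one per step while k shrinks, so B stays large enough.
  walks≡alternatingSum : ∀ k p D B → SameParity p → InR2 m p → Bound D p → k ℕ.+ D ℕ.+ 1 ℕ.≤ B →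
                         + walks k m p l ≡ alternatingSum B k p
  walks≡alternatingSum zero p D B par Rp bound k+D<B = sym (alternatingSum-zero B p Rp Rl)
  walks≡alternatingSum (suc k) p D B par Rp bound k+D<B = begin
    + walks (suc k) m p l
      ≡⟨ cong +_ (walks-suc k m p l Rp) ⟩
    + sumℕ (L.map (λ s → walks k m (vadd p s) l) (steps N))
      ≡⟨ +-sumℕ (steps N) (λ s → walks k m (vadd p s) l) ⟩
    ∑[ s ∈ steps N ] (+ walks k m (vadd p s) l)
      ≡⟨ ∑ˡ-cong-All (All.map (λ {s} → afterStep s) (steps-IsStep N)) ⟩
    ∑[ s ∈ steps N ] alternatingSum B k (vadd p s)
      ≡⟨ alternatingSum-suc B k p ⟨
    alternatingSum B (suc k) p ∎
    where
    open ≡-Reasoning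
    N = suc (suc n)
    k+D′<B : k ℕ.+ suc D ℕ.+ 1 ℕ.≤ B
    k+D′<B = subst (λ x → x ℕ.+ 1 ℕ.≤ B) (sym (ℕP.+-suc k D)) k+D<B
    afterStep : ∀ s → IsStep s → + walks k m (vadd p s) l ≡ alternatingSum B k (vadd p s)
    afterStep s step with inR2ᵇ m (vadd p s) in inside
    ... | true = walks≡alternatingSum k (vadd p s) (suc D) B (SameParity-step p s par step) inside
                                      (Bound-step D p s bound step) k+D′<B
    ... | false with exit-through-wall m p s par step Rp inside
    ...   | inj₁ (i , j , i≢j , collision) =
            trans (cong +_ (walks-outside k m (vadd p s) l inside))
                  (sym (alternatingSum-collision B k (vadd p s) i≢j collision))
    ...   | inj₂ onAffineWall =
            trans (cong +_ (walks-outside k m (vadd p s) l inside))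
                  (sym (alternatingSum-affineWall B k (vadd p s) (suc D) (λ ()) m≥1 (Bound-step D p s bound step)
                                                  k+D′<B onAffineWall))

mainTheorem5 : (n m : ℕ) → n ≥ 2 → m ≥ 1 →
    (e l : Vec ℤ n) → InR2 m e → InR2 m l → sameParity e → sameParity l →
    (k : ℕ) →
    Σ ℕ (λ B →
      ((t : Vec ℤ n) → vsum t ≡ + 0 → ¬ inBox B t → summand k m e l t ≡ + 0)
      × (+ walks k m e l ≡ boxSum B k m e l))
mainTheorem5 (suc zero) _ (ℕ.s≤s ()) _ _ _ _ _ _ _ _
-- Only η needs coordinates of equal parity.
mainTheorem5 (suc (suc n)) m _ m≥1 e l Re Rl pe _ k = B , vanishes , counts
  where
  open AlternatingSum (suc (suc n)) m l
  open Counting n m l m≥1 Rl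
  D B : ℕ
  D = sumAbs l ℕ.+ sumAbs e
  B = k ℕ.+ D ℕ.+ 1
  vanishes : (t : Vec ℤ (suc (suc n))) → vsum t ≡ + 0 → ¬ inBox B t → summand k m e l t ≡ + 0
  vanishes t _ outside with FP.¬∀⟶∃¬ _ _ (λ i → ℤ.∣ lookup t i ∣ ℕ.≤? B) outside
  ... | i , ∣tᵢ∣≰B = summand-far k e D m≥1 (Bound-initial e) t i (ℕP.<⇒≤ (ℕP.≰⇒> ∣tᵢ∣≰B))
  counts : + walks k m e l ≡ boxSum B k m e l
  counts = trans (walks≡alternatingSum k e D B (sameParity⇒SameParity e pe) Re (Bound-initial e) ℕP.≤-refl)
                 (sym (boxSum≡alternatingSum B k e))
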